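{- Let $G$ be a finite directed graph with $n$ vertices and $m$ arcs, $n=\mathrm{O}(m)$, given by adjacency lists. Algorithm T (described in the context) outputs a partition of the vertex set of $G$ that is exactly the partition into strong components, and it runs in $\mathrm{O}(m)$ time.
   Context: Loops and parallel arcs are allowed; each arc goes from its tail to its tip. Two vertices are mutually reachable if each is reachable from the other by a directed path; the equivalence classes of this relation are the strong components. A depth-first exploration proceeds as follows. Initially all vertices are unvisited, all arcs untraversed, and the current vertex is null. Repeat the applicable case until all vertices are visited and all arcs are traversed: (i) The current vertex is null and some vertex is unvisited: choose any unvisited vertex $v$, make it current and visit it; $v$ is the start vertex (root) of a new search. (ii) The current vertex $v$ has an untraversed exiting arc: choose any such arc $a$, from $v$ to $w$, and advance on it. If $w$ is already visited, immediately retreat on $a$. Otherwise $a$ becomes a tree arc, $w$ becomes current, and $w$ is visited. (iii) The current vertex $v$ has no untraversed exiting arc: if $v$ is the root of the current search, the current vertex becomes null; otherwise retreat on the tree arc entering $v$, say from $u$, and make $u$ current. The visit of $v$ (when it first becomes visited) is its previsit. The step (iii) at which $v$ is current and has no untraversed exiting arc is its postvisit. Algorithm T performs one depth-first exploration of $G$ with the following extra actions. It maintains a stack $F$ (initially empty) and an integer counter (initially $0$). - Previsit of $v$: increment the counter, set $v.\mathit{pre}$ to the counter (so the preorder numbers are $1,2,\dots$), and set $v.\mathit{low}\gets v.\mathit{pre}$. - Retreat on any arc from $v$ to $w$ (tree or non-tree): set $v.\mathit{low}\gets\min\{v.\mathit{low},w.\mathit{low}\}$. - Postvisit of $v$: -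 If $v.\mathit{low}\neq v.\mathit{pre}$, push $v$ onto $F$. - Otherwise, repeatedly pop the top vertex $x$ of $F$, while $F$ is nonempty and $x.\mathit{low}\ge v.\mathit{low}$; put each popped $x$ into the output set of $v$ and set $x.\mathit{low}\gets\infty$. Then put $v$ into its own output set, set $v.\mathit{low}\gets\infty$, and output this set. Here $\infty$ exceeds every integer. -}

module Defs where

open import Data.Nat using (ℕ; zero; suc; _≤_; _+_; _*_; _⊓_)
open import Data.Fin using (Fin; _≟_)
open import Data.Bool using (Bool; true; false; if_then_else_)
open import Data.Maybe using (Maybe; just; nothing)
open import Data.List using (List; []; _∷_)
open import Data.List.Membership.Propositional using (_∈_)
open import Data.List.Relation.Unary.Any using (Any; index)
open import Data.Product using (Σ; _×_; _,_; ∃; ∃-syntax)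
open import Data.Unit using (⊤)
open import Data.Empty using (⊥)
open import Relation.Nullary using (¬_; does)
open import Relation.Binary.PropositionalEquality using (_≡_)

-- Finite directed graphs: vertices Fin n, arcs Fin m, each arc has a
-- tail and a tip.  Loops and parallel arcs are allowed.

record Digraph : Set where
  field
    n    : ℕ
    m    : ℕ
    tail : Fin m → Fin n
    tip  : Fin m → Fin n
open Digraph public

data Reach (G : Digraph) : Fin (n G) → Fin (n G) → Set where
  here : ∀ {u} → Reach G u u
  step : ∀ {u w} (a : Fin (m G)) → tail G a ≡ u → Reach G (tip G a) w → Reach G u w

MutuallyReachable : (G : Digraph) → Fin (n G) → Fin (n G) → Set
MutuallyReachable G u w = Reach G u w × Reach G w u

data ℕ∞ : Set where
  fin : ℕ → ℕ∞
  ∞   : ℕ∞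

_≤∞_ : ℕ∞ → ℕ∞ → Set
fin a ≤∞ fin b = a ≤ b
fin a ≤∞ ∞     = ⊤
∞     ≤∞ fin b = ⊥
∞     ≤∞ ∞     = ⊤

min∞ : ℕ∞ → ℕ∞ → ℕ∞
min∞ (fin a) (fin b) = fin (a ⊓ b)
min∞ (fin a) ∞       = fin a
min∞ ∞       y       = y

update : ∀ {k} {A : Set} → (Fin k → A) → Fin k → A → Fin k → A
update f i x j = if does (i ≟ j) then x else f j

data Phase (k : ℕ) : Set where
  explore : Phase k
  -- in the middle of the postvisit of v, with v.low = v.pre; the list is
  -- the part of the output set of v popped from F so far
  popping : Fin k → List (Fin k) → Phase k

record State (G : Digraph) : Set where
  field
    visited   : Fin (n G) → Bool
    traversed : Fin (m G) → Bool
    current   : Maybe (Fin (n G))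
    treeIn    : Fin (n G) → Maybe (Fin (m G))   -- tree arc entering v (nothing for a root)
    counter   : ℕ
    pre       : Fin (n G) → ℕ
    low       : Fin (n G) → ℕ∞
    F         : List (Fin (n G))
    phase     : Phase (n G)
    outputs   : List (List (Fin (n G)))          -- output sets, most recent first
open State public

initial : (G : Digraph) → State G
initial G = record
  { visited   = λ _ → false
  ; traversed = λ _ → false
  ; current   = nothing
  ; treeIn    = λ _ → nothing
  ; counter   = 0
  ; pre       = λ _ → 0
  ; low       = λ _ → ∞
  ; F         = []
  ; phase     = explore
  ; outputs   = []
  }

previsit : ∀ {G} → Fin (n G) → Maybe (Fin (m G)) → State G → State G
previsit v t s = record s
  { visited = update (visited s) v true
  ; current = just v
  ; treeIn  = update (treeIn s) v t
  ; counter = suc (counter s)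
  ; pre     = update (pre s) v (suc (counter s))
  ; low     = update (low s) v (fin (suc (counter s)))
  }

leave : ∀ {G} → Fin (n G) → State G → State G
leave {G} v s with treeIn s v
... | nothing = record s { current = nothing }
... | just a  = record s
  { current = just (tail G a)
  ; low     = update (low s) (tail G a) (min∞ (low s (tail G a)) (low s v))
  }

-- One elementary step of Algorithm T (each step costs one time unit).
data Step (G : Digraph) : State G → State G → Set where
  start : ∀ s v →
    phase s ≡ explore → current s ≡ nothing → visited s v ≡ false →
    Step G s (previsit v nothing s)
  -- case (ii), tip already visited: advance and immediately retreat
  advance-visited : ∀ s v a →
    phase s ≡ explore → current s ≡ just v → tail G a ≡ v →
    traversed s a ≡ false → visited s (tip G a) ≡ true →
    Step G s (record s
      { traversed = update (traversed s) a true
      ; low       = update (low s) v (min∞ (low s v) (low s (tip G a))) })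
  advance-tree : ∀ s v a →
    phase s ≡ explore → current s ≡ just v → tail G a ≡ v →
    traversed s a ≡ false → visited s (tip G a) ≡ false →
    Step G s (previsit (tip G a) (just a)
                (record s { traversed = update (traversed s) a true }))
  postvisit-push : ∀ s v →
    phase s ≡ explore → current s ≡ just v →
    (∀ a → tail G a ≡ v → traversed s a ≡ true) →
    ¬ (low s v ≡ fin (pre s v)) →
    Step G s (leave v (record s { F = v ∷ F s }))
  postvisit-root : ∀ s v →
    phase s ≡ explore → current s ≡ just v →
    (∀ a → tail G a ≡ v → traversed s a ≡ true) →
    low s v ≡ fin (pre s v) →
    Step G s (record s { phase = popping v [] })
  pop : ∀ s v S x F' →
    phase s ≡ popping v S → F s ≡ x ∷ F' → low s v ≤∞ low s x →
    Step G s (record s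
      { F     = F'
      ; phase = popping v (x ∷ S)
      ; low   = update (low s) x ∞ })
  pop-done : ∀ s v S →
    phase s ≡ popping v S →
    (∀ x F' → F s ≡ x ∷ F' → ¬ (low s v ≤∞ low s x)) →
    Step G s (leave v (record s
      { phase   = explore
      ; outputs = (v ∷ S) ∷ outputs s
      ; low     = update (low s) v ∞ }))

data Steps (G : Digraph) : ℕ → State G → State G → Set where
  done : ∀ {s} → Steps G 0 s s
  _▸_  : ∀ {k s s' s''} → Step G s s' → Steps G k s' s'' → Steps G (suc k) s s''

Terminal : (G : Digraph) → State G → Set
Terminal G s = ¬ (∃[ s' ] Step G s s')

IsSCCPartition : (G : Digraph) → List (List (Fin (n G))) → Set
IsSCCPartition G P =
  (∀ S → S ∈ P → ∃[ v ] v ∈ S) ×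
  (∀ v → ∃[ S ] v ∈ S × S ∈ P) ×
  (∀ {S T u w} (p : S ∈ P) (q : T ∈ P) → u ∈ S → w ∈ T →
     (index p ≡ index q → MutuallyReachable G u w) ×
     (MutuallyReachable G u w → index p ≡ index q))

{-# OPTIONS --safe #-}

-- The search path and the stack F are grouped into segments: each vertex a
-- on the path owns the vertices of F pushed after a was visited.  Owned
-- vertices and their owner reach each other, and every low value is the
-- preorder number of a vertex still on the path or in F that is reachable
-- from its bearer.  When v finishes with v.low = v.pre, no traversed arc
-- leaves v's segment, so the segment is closed under mutual reachability
-- with v, and popping outputs exactly the strong component of v.  For the running time, every step raises a
-- potential, built from the numbers of traversed arcs and of vertices on
-- the path, in F and in output sets, which never exceeds m + 5n + 1.

module Submission where

open import Defs
import Data.Bool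
open import Data.Bool using (Bool; true; false; if_then_else_)
open import Data.Bool.Properties using (¬-not)
open import Data.Empty using (⊥; ⊥-elim)
open import Data.Fin using (Fin; _≟_) renaming (zero to fzero; suc to fsuc)
open import Data.Fin.Properties using (any?; toℕ<n)
open import Data.List using (List; []; _∷_; _++_; length; concat; lookup)
open import Data.List.Membership.Propositional using (_∈_; _∉_)
open import Data.List.Membership.Propositional.Properties
  using (∈-++⁺ˡ; ∈-++⁺ʳ; ∈-++⁻; ∈-concat⁺′; ∈-concat⁻′)
open import Data.List.Properties using (length-++; ++-assoc; ∷-injective)
open import Data.List.Relation.Binary.Permutation.Propositional
  using (_↭_; prep; swap; ↭-refl; ↭-reflexive; ↭-sym; ↭-trans)
open import Data.List.Relation.Binary.Permutation.Propositional.Properties using (↭-length; ∈-resp-↭; shift; ++⁺ʳ)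
open import Data.List.Relation.Unary.Any using (here; there; index)
open import Data.List.Relation.Unary.Any.Properties using (lookup-index)
open import Data.Maybe using (Maybe; just; nothing)
open import Data.Maybe.Properties using (just-injective)
import Data.Nat
open import Data.Nat using (ℕ; zero; suc; _≤_; _<_; _+_; _*_; z≤n; s≤s; _≤?_)
open import Data.Nat.Properties hiding (_≟_)
open import Data.Nat.Tactic.RingSolver using (solve-∀)
open import Data.Product using (_×_; _,_; ∃-syntax; proj₁; proj₂)
open import Data.Sum using (_⊎_; inj₁; inj₂; [_,_]′; map₁)
open import Data.Unit using (⊤; tt)
open import Function using (case_of_)
open import Relation.Binary.PropositionalEquality
open import Relation.Nullary using (¬_; Dec; does; yes; no)
open import Relation.Nullary.Decidable using (_×-dec_)

module _ {k : ℕ} {A : Set} where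

  update-≡ : (f : Fin k → A) (i : Fin k) (x : A) → update f i x i ≡ x
  update-≡ f i x with i ≟ i
  ... | yes _ = refl
  ... | no i≢i = ⊥-elim (i≢i refl)

  update-≢ : (f : Fin k → A) {i j : Fin k} (x : A) → i ≢ j → update f i x j ≡ f j
  update-≢ f {i} {j} x i≢j with i ≟ j
  ... | yes i≡j = ⊥-elim (i≢j i≡j)
  ... | no _ = refl

  update-self : (f : Fin k → A) (i j : Fin k) → update f i (f i) j ≡ f j
  update-self f i j with i ≟ j
  ... | yes refl = refl
  ... | no _ = refl

module _ {k : ℕ} where

  update-true : (f : Fin k → Bool) (i : Fin k) {j : Fin k} → f j ≡ true → update f i true j ≡ true
  update-true f i {j} fj with i ≟ j
  ... | yes _ = refl
  ... | no _ = fj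

  update-true⁻ : (f : Fin k → Bool) (i : Fin k) {j : Fin k} → update f i true j ≡ true → i ≡ j ⊎ f j ≡ true
  update-true⁻ f i {j} fj with i ≟ j
  ... | yes i≡j = inj₁ i≡j
  ... | no _ = inj₂ fj

-- Finite sums, multiplicities and duplicate-free lists

∑ : {k : ℕ} → (Fin k → ℕ) → ℕ
∑ {zero} f = 0
∑ {suc k} f = f fzero + ∑ (λ i → f (fsuc i))

∑-cong : ∀ {k} {f g : Fin k → ℕ} → (∀ i → f i ≡ g i) → ∑ f ≡ ∑ g
∑-cong {zero} f≗g = refl
∑-cong {suc k} f≗g = cong₂ _+_ (f≗g fzero) (∑-cong (λ i → f≗g (fsuc i)))

∑-mono-≤ : ∀ {k} {f g : Fin k → ℕ} → (∀ i → f i ≤ g i) → ∑ f ≤ ∑ g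
∑-mono-≤ {zero} f≤g = z≤n
∑-mono-≤ {suc k} f≤g = +-mono-≤ (f≤g fzero) (∑-mono-≤ (λ i → f≤g (fsuc i)))

∑-distrib-+ : ∀ {k} (f g : Fin k → ℕ) → ∑ (λ i → f i + g i) ≡ ∑ f + ∑ g
∑-distrib-+ {zero} f g = refl
∑-distrib-+ {suc k} f g
  rewrite ∑-distrib-+ (λ i → f (fsuc i)) (λ i → g (fsuc i)) =
  +-exchange (f fzero) (g fzero) (∑ (λ i → f (fsuc i))) (∑ (λ i → g (fsuc i)))
  where
  +-exchange : ∀ a b c d → (a + b) + (c + d) ≡ (a + c) + (b + d)
  +-exchange = solve-∀

∑-const : ∀ k (c : ℕ) → ∑ {k} (λ _ → c) ≡ k * c
∑-const zero c = refl
∑-const (suc k) c = cong (c +_) (∑-const k c)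

∑-update : ∀ {k} (f : Fin k → ℕ) (i : Fin k) (x : ℕ) → ∑ (update f i x) + f i ≡ ∑ f + x
∑-update {suc k} f fzero x = swap-ends x (∑ (λ j → f (fsuc j))) (f fzero)
  where
  swap-ends : ∀ a b c → a + b + c ≡ c + b + a
  swap-ends = solve-∀
∑-update {suc k} f (fsuc i) x = begin
  f fzero + ∑ (update (λ j → f (fsuc j)) i x) + f (fsuc i)  ≡⟨ +-assoc (f fzero) _ _ ⟩
  f fzero + (∑ (update (λ j → f (fsuc j)) i x) + f (fsuc i))  ≡⟨ cong (f fzero +_) (∑-update (λ j → f (fsuc j)) i x) ⟩
  f fzero + (∑ (λ j → f (fsuc j)) + x)  ≡⟨ +-assoc (f fzero) _ x ⟨
  f fzero + ∑ (λ j → f (fsuc j)) + x  ∎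
  where open ≡-Reasoning

trueCount : ∀ {k} → (Fin k → Bool) → ℕ
trueCount t = ∑ (λ i → if t i then 1 else 0)

trueCount≤ : ∀ {k} (t : Fin k → Bool) → trueCount t ≤ k
trueCount≤ {k} t = begin
  trueCount t    ≤⟨ ∑-mono-≤ (λ i → indicator≤1 (t i)) ⟩
  ∑ {k} (λ _ → 1) ≡⟨ ∑-const k 1 ⟩
  k * 1          ≡⟨ *-identityʳ k ⟩
  k              ∎
  where
  open ≤-Reasoning
  indicator≤1 : ∀ b → (if b then 1 else 0) ≤ 1
  indicator≤1 true = ≤-refl
  indicator≤1 false = z≤n

trueCount-update : ∀ {k} (t : Fin k → Bool) (a : Fin k) → t a ≡ false →
                   trueCount (update t a true) ≡ suc (trueCount t)
trueCount-update {k} t a ta≡false = begin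
  trueCount (update t a true)       ≡⟨ ∑-cong indicator-update ⟩
  ∑ (update indicator a 1)          ≡⟨ +-identityʳ _ ⟨
  ∑ (update indicator a 1) + 0      ≡⟨ cong (∑ (update indicator a 1) +_) (cong (λ b → if b then 1 else 0) ta≡false) ⟨
  ∑ (update indicator a 1) + indicator a ≡⟨ ∑-update indicator a 1 ⟩
  trueCount t + 1                   ≡⟨ +-comm _ 1 ⟩
  suc (trueCount t)                 ∎
  where
  open ≡-Reasoning
  indicator : Fin k → ℕ
  indicator i = if t i then 1 else 0
  indicator-update : ∀ i → (if update t a true i then 1 else 0) ≡ update indicator a 1 i
  indicator-update i with a ≟ i
  ... | yes _ = refl
  ... | no _ = refl

δ : ∀ {k} → Fin k → Fin k → ℕ
δ y x = if does (y ≟ x) then 1 else 0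

count : ∀ {k} → Fin k → List (Fin k) → ℕ
count x [] = 0
count x (y ∷ ys) = δ y x + count x ys

module _ {k : ℕ} where

  count-++ : (x : Fin k) (xs ys : List (Fin k)) → count x (xs ++ ys) ≡ count x xs + count x ys
  count-++ x [] ys = refl
  count-++ x (y ∷ xs) ys = trans (cong (δ y x +_) (count-++ x xs ys)) (sym (+-assoc (δ y x) (count x xs) _))

  count-here : (x : Fin k) (ys : List (Fin k)) → count x (x ∷ ys) ≡ suc (count x ys)
  count-here x ys with x ≟ x
  ... | yes _ = refl
  ... | no x≢x = ⊥-elim (x≢x refl)

  ∈⇒1≤count : {x : Fin k} {ys : List (Fin k)} → x ∈ ys → 1 ≤ count x ys
  ∈⇒1≤count {x} {_ ∷ ys} (here refl) = subst (1 ≤_) (sym (count-here x ys)) (s≤s z≤n)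
  ∈⇒1≤count {x} {y ∷ ys} (there x∈ys) = ≤-trans (∈⇒1≤count x∈ys) (m≤n+m _ _)

  ∉⇒count≡0 : {x : Fin k} {ys : List (Fin k)} → x ∉ ys → count x ys ≡ 0
  ∉⇒count≡0 {ys = []} _ = refl
  ∉⇒count≡0 {x} {y ∷ ys} x∉ with y ≟ x
  ... | yes y≡x = ⊥-elim (x∉ (here (sym y≡x)))
  ... | no _ = ∉⇒count≡0 (λ x∈ys → x∉ (there x∈ys))

  count-resp-↭ : (x : Fin k) {xs ys : List (Fin k)} → xs ↭ ys → count x xs ≡ count x ys
  count-resp-↭ x _↭_.refl = refl
  count-resp-↭ x (prep y xs↭ys) = cong (δ y x +_) (count-resp-↭ x xs↭ys)
  count-resp-↭ x (swap {xs} {ys} y z xs↭ys) = begin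
    a + (b + count x xs)  ≡⟨ +-assoc a b _ ⟨
    a + b + count x xs    ≡⟨ cong₂ _+_ (+-comm a b) (count-resp-↭ x xs↭ys) ⟩
    b + a + count x ys    ≡⟨ +-assoc b a _ ⟩
    b + (a + count x ys)  ∎
    where
    open ≡-Reasoning
    a = δ y x
    b = δ z x
  count-resp-↭ x (_↭_.trans xs↭ys ys↭zs) = trans (count-resp-↭ x xs↭ys) (count-resp-↭ x ys↭zs)

  length≡∑count : (ys : List (Fin k)) → length ys ≡ ∑ (λ x → count x ys)
  length≡∑count [] = sym (trans (∑-const k 0) (*-zeroʳ k))
  length≡∑count (y ∷ ys) = begin
    suc (length ys)                  ≡⟨ cong suc (length≡∑count ys) ⟩
    1 + ∑ (λ x → count x ys)         ≡⟨ cong (_+ ∑ (λ x → count x ys)) ∑δ≡1 ⟨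
    ∑ (δ y) + ∑ (λ x → count x ys)   ≡⟨ ∑-distrib-+ (δ y) (λ x → count x ys) ⟨
    ∑ (λ x → count x (y ∷ ys))       ∎
    where
    open ≡-Reasoning
    ∑δ≡1 : ∑ (δ y) ≡ 1
    ∑δ≡1 = begin
      ∑ (δ y)                      ≡⟨⟩
      ∑ (update (λ _ → 0) y 1)     ≡⟨ +-identityʳ _ ⟨
      ∑ (update (λ _ → 0) y 1) + 0 ≡⟨ ∑-update (λ _ → 0) y 1 ⟩
      ∑ {k} (λ _ → 0) + 1          ≡⟨ cong (_+ 1) (trans (∑-const k 0) (*-zeroʳ k)) ⟩
      1                            ∎

Distinct : ∀ {k} → List (Fin k) → Set
Distinct ys = ∀ x → count x ys ≤ 1

module _ {k : ℕ} where

  Distinct⇒length≤ : (ys : List (Fin k)) → Distinct ys → length ys ≤ k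
  Distinct⇒length≤ ys distinct = begin
    length ys                ≡⟨ length≡∑count ys ⟩
    ∑ (λ x → count x ys)     ≤⟨ ∑-mono-≤ distinct ⟩
    ∑ {k} (λ _ → 1)          ≡⟨ trans (∑-const k 1) (*-identityʳ k) ⟩
    k                        ∎
    where open ≤-Reasoning

  Distinct-resp-↭ : {xs ys : List (Fin k)} → xs ↭ ys → Distinct xs → Distinct ys
  Distinct-resp-↭ xs↭ys distinct x = subst (_≤ 1) (count-resp-↭ x xs↭ys) (distinct x)

  Distinct-++⇒∉ : (xs : List (Fin k)) {ys : List (Fin k)} {x : Fin k} →
                  Distinct (xs ++ ys) → x ∈ xs → x ∉ ys
  Distinct-++⇒∉ xs {ys} {x} distinct x∈xs x∈ys = 1+n≰n (begin
    2                        ≤⟨ +-mono-≤ (∈⇒1≤count x∈xs) (∈⇒1≤count x∈ys) ⟩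
    count x xs + count x ys  ≡⟨ count-++ x xs ys ⟨
    count x (xs ++ ys)       ≤⟨ distinct x ⟩
    1                        ∎)
    where open ≤-Reasoning

  Distinct-∷⁺ : {x : Fin k} {ys : List (Fin k)} → x ∉ ys → Distinct ys → Distinct (x ∷ ys)
  Distinct-∷⁺ {x} {ys} x∉ys distinct z with x ≟ z
  ... | yes refl = subst (λ c → suc c ≤ 1) (sym (∉⇒count≡0 x∉ys)) ≤-refl
  ... | no _ = distinct z

module _ {A : Set} where

  index-injective : {S T : A} {P : List A} (p : S ∈ P) (q : T ∈ P) → index p ≡ index q → S ≡ T
  index-injective {P = P} p q i≡j = trans (lookup-index p) (trans (cong (lookup P) i≡j) (sym (lookup-index q)))

module _ {k : ℕ} where

  Distinct-concat⇒index≡ : (P : List (List (Fin k))) {S T : List (Fin k)} {w : Fin k}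
                          (p : S ∈ P) (q : T ∈ P) → w ∈ S → w ∈ T → Distinct (concat P) → index p ≡ index q
  Distinct-concat⇒index≡ (_ ∷ P) (here refl) (here refl) _ _ _ = refl
  Distinct-concat⇒index≡ (X ∷ P) (there p) (there q) w∈S w∈T distinct =
    cong fsuc (Distinct-concat⇒index≡ P p q w∈S w∈T (λ x → ≤-trans (count-suffix x) (distinct x)))
    where
    count-suffix : ∀ x → count x (concat P) ≤ count x (X ++ concat P)
    count-suffix x = subst (count x (concat P) ≤_) (sym (count-++ x X (concat P))) (m≤n+m _ _)
  Distinct-concat⇒index≡ (X ∷ P) (here refl) (there q) w∈S w∈T distinct =
    ⊥-elim (Distinct-++⇒∉ X distinct w∈S (∈-concat⁺′ w∈T q))
  Distinct-concat⇒index≡ (X ∷ P) (there p) (here refl) w∈S w∈T distinct =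
    ⊥-elim (Distinct-++⇒∉ X distinct w∈T (∈-concat⁺′ w∈S p))

≤∞-refl : ∀ {a} → a ≤∞ a
≤∞-refl {fin a} = ≤-refl
≤∞-refl {∞} = _

≤∞-trans : ∀ {a b c} → a ≤∞ b → b ≤∞ c → a ≤∞ c
≤∞-trans {fin a} {fin b} {fin c} a≤b b≤c = ≤-trans a≤b b≤c
≤∞-trans {fin a} {fin b} {∞} _ _ = _
≤∞-trans {fin a} {∞} {∞} _ _ = _
≤∞-trans {∞} {∞} {∞} _ _ = _

≤∞fin⇒fin : ∀ {a b} → a ≤∞ fin b → ∃[ l ] (a ≡ fin l × l ≤ b)
≤∞fin⇒fin {fin a} a≤b = a , refl , a≤b

min∞-≤ˡ : ∀ a b → min∞ a b ≤∞ a
min∞-≤ˡ (fin a) (fin b) = m⊓n≤m a b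
min∞-≤ˡ (fin a) ∞ = ≤-refl
min∞-≤ˡ ∞ (fin b) = _
min∞-≤ˡ ∞ ∞ = _

min∞-≤ʳ : ∀ a b → min∞ a b ≤∞ b
min∞-≤ʳ (fin a) (fin b) = m⊓n≤n a b
min∞-≤ʳ (fin a) ∞ = _
min∞-≤ʳ ∞ b = ≤∞-refl

min∞-identityʳ : ∀ a → min∞ a ∞ ≡ a
min∞-identityʳ (fin a) = refl
min∞-identityʳ ∞ = refl

min∞-witness : ∀ {A : Set} (f : A → ℕ) (P : A → Set) {a b x y} →
               a ≡ fin (f x) → P x → b ≡ fin (f y) → P y → ∃[ z ] (min∞ a b ≡ fin (f z) × P z)
min∞-witness f P {x = x} {y} refl Px refl Py with ≤-total (f x) (f y)
... | inj₁ fx≤fy = x , cong fin (m≤n⇒m⊓n≡m fx≤fy) , Px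
... | inj₂ fy≤fx = y , cong fin (m≥n⇒m⊓n≡n fy≤fx) , Py

_≤∞?_ : ∀ a b → Dec (a ≤∞ b)
fin a ≤∞? fin b = a ≤? b
fin a ≤∞? ∞ = yes _
∞ ≤∞? fin b = no (λ ())
∞ ≤∞? ∞ = yes _

_≟∞_ : (a b : ℕ∞) → Dec (a ≡ b)
fin a ≟∞ fin b with a Data.Nat.≟ b
... | yes refl = yes refl
... | no a≢b = no (λ { refl → a≢b refl })
fin a ≟∞ ∞ = no (λ ())
∞ ≟∞ fin b = no (λ ())
∞ ≟∞ ∞ = yes refl

-- Segments and the invariant

module AlgorithmT (G : Digraph) where

  V : Set
  V = Fin (n G)

  Arc : Set
  Arc = Fin (m G)

  infixr 5 _◅◅_
  _◅◅_ : ∀ {u v w} → Reach G u v → Reach G v w → Reach G u w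
  here ◅◅ q = q
  step a tail≡ p ◅◅ q = step a tail≡ (p ◅◅ q)

  arc⇒Reach : ∀ {u w} (a : Arc) → tail G a ≡ u → tip G a ≡ w → Reach G u w
  arc⇒Reach a refl refl = step a refl here

  -- Segments are listed topmost first; F is the concatenation of their
  -- member lists.
  Segment : Set
  Segment = V × List V

  vertices : List Segment → List V
  vertices [] = []
  vertices ((a , xs) ∷ below) = a ∷ xs ++ vertices below

  members : List Segment → List V
  members [] = []
  members ((a , xs) ∷ below) = xs ++ members below

  top : List Segment → Maybe V
  top [] = nothing
  top ((a , _) ∷ _) = just a

  TreePath : (V → Maybe Arc) → List Segment → Set
  TreePath treeIn [] = ⊤
  TreePath treeIn ((a , _) ∷ []) = treeIn a ≡ nothing
  TreePath treeIn ((a , _) ∷ (b , ys) ∷ below) =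
    (∃[ e ] (treeIn a ≡ just e × tail G e ≡ b × tip G e ≡ a)) × TreePath treeIn ((b , ys) ∷ below)

  record SegmentInvariant (pre : V → ℕ) (low : V → ℕ∞) (traversed : Arc → Bool)
                          (a : V) (xs : List V) (below : List Segment) : Set where
    field
      owner<member    : ∀ {x} → x ∈ xs → pre a < pre x
      below<owner     : ∀ {y} → y ∈ vertices below → pre y < pre a
      low-owner       : ∃[ l ] (low a ≡ fin l × l ≤ pre a)
      low-member      : ∀ {x} → x ∈ xs → ∃[ l ] (low x ≡ fin l × l < pre x × low a ≤∞ fin l)
      member↔owner    : ∀ {x} → x ∈ xs → Reach G x a × Reach G a x
      low-witness     : ∀ {y} → y ∈ a ∷ xs →
                        ∃[ z ] (z ∈ vertices ((a , xs) ∷ below) × low y ≡ fin (pre z) × Reach G y z)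
      member-finished : ∀ {x} → x ∈ xs → ∀ e → tail G e ≡ x → traversed e ≡ true

  SegmentsInvariant : (pre : V → ℕ) (low : V → ℕ∞) (traversed : Arc → Bool) → List Segment → Set
  SegmentsInvariant pre low traversed [] = ⊤
  SegmentsInvariant pre low traversed ((a , xs) ∷ below) =
    SegmentInvariant pre low traversed a xs below × SegmentsInvariant pre low traversed below

  record PoppingInvariant (pre : V → ℕ) (low : V → ℕ∞) (v : V) (xs : List V) (below : List Segment) : Set where
    field
      low-root     : low v ≡ fin (pre v)
      low-member   : ∀ {x} → x ∈ xs → ∃[ l ] (low x ≡ fin l × pre v ≤ l)
      member↔root  : ∀ {x} → x ∈ xs → Reach G x v × Reach G v x
      below<root   : ∀ {y} → y ∈ vertices below → pre y < pre v

  PhaseInvariant : (pre : V → ℕ) (low : V → ℕ∞) (traversed : Arc → Bool) → Phase (n G) → List Segment → Set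
  PhaseInvariant pre low traversed explore segs = SegmentsInvariant pre low traversed segs
  PhaseInvariant pre low traversed (popping v S) segs =
    ∃[ xs ] ∃[ below ] (segs ≡ (v , xs) ∷ below × PoppingInvariant pre low v xs below
      × SegmentsInvariant pre low traversed below
      × (∀ {x} → x ∈ S → MutuallyReachable G v x)
      × (∀ w → MutuallyReachable G v w → w ≡ v ⊎ w ∈ xs ⊎ w ∈ S))

  popped : Phase (n G) → List V
  popped explore = []
  popped (popping v S) = S

  assigned : State G → List V
  assigned s = popped (phase s) ++ concat (outputs s)

  record IsComponent (O : List V) : Set where
    field
      nonempty  : ∃[ v ] v ∈ O
      connected : ∀ {u w} → u ∈ O → w ∈ O → Reach G u w
      closed    : ∀ {u w} → u ∈ O → Reach G u w → Reach G w u → w ∈ O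

  record Invariant (s : State G) (segs : List Segment) : Set where
    field
      current≡top            : current s ≡ top segs
      F≡members              : F s ≡ members segs
      treePath               : TreePath (treeIn s) segs
      phase-invariant        : PhaseInvariant (pre s) (low s) (traversed s) (phase s) segs
      vertices-visited       : ∀ {y} → y ∈ vertices segs → visited s y ≡ true
      assigned-visited       : ∀ {y} → y ∈ assigned s → visited s y ≡ true
      pre≤counter            : ∀ {y} → y ∈ vertices segs → pre s y ≤ counter s
      traversed⇒tip-visited  : ∀ e → traversed s e ≡ true → visited s (tip G e) ≡ true
      traversed⇒tail-visited : ∀ e → traversed s e ≡ true → visited s (tail G e) ≡ true
      visited⇒located        : ∀ y → visited s y ≡ true → y ∈ vertices segs ⊎ y ∈ assigned s
      assigned-low∞          : ∀ {y} → y ∈ assigned s → low s y ≡ ∞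
      traversed-low≤pre      : ∀ {y t} e → y ∈ vertices segs → t ∈ vertices segs → tail G e ≡ y → tip G e ≡ t →
                               traversed s e ≡ true → low s y ≤∞ fin (pre s t)
      distinct               : Distinct (vertices segs ++ assigned s)
      outputs-components     : ∀ {O} → O ∈ outputs s → IsComponent O

  poppingFlag : Phase (n G) → ℕ
  poppingFlag explore = 0
  poppingFlag (popping _ _) = 1

  -- Every step raises the potential by at least one.  The weight 3 pays for
  -- a pop, which takes a vertex out of the segments and out of F, and for
  -- the end of popping, which takes the root out of the segments and clears
  -- the flag.
  potential : State G → List Segment → ℕ
  potential s segs = trueCount (traversed s) + length (vertices segs) + 3 * length (assigned s)
                   + length (F s) + poppingFlag (phase s)

  Improves : State G → List Segment → State G → Set
  Improves s segs s' = ∃[ segs' ] (Invariant s' segs' × potential s segs < potential s' segs')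

  Progress : State G → State G → Set
  Progress s s' = ∀ {segs} → Invariant s segs → Improves s segs s'

  member∈ : ∀ {a xs below x} → x ∈ xs → x ∈ vertices ((a , xs) ∷ below)
  member∈ x∈xs = there (∈-++⁺ˡ x∈xs)

  below∈ : ∀ {a xs below y} → y ∈ vertices below → y ∈ vertices ((a , xs) ∷ below)
  below∈ {xs = xs} y∈below = there (∈-++⁺ʳ xs y∈below)

  ∈vertices⁻ : ∀ {a xs below y} → y ∈ vertices ((a , xs) ∷ below) → y ≡ a ⊎ y ∈ xs ⊎ y ∈ vertices below
  ∈vertices⁻ (here y≡a) = inj₁ y≡a
  ∈vertices⁻ {xs = xs} (there y∈) with ∈-++⁻ xs y∈
  ... | inj₁ y∈xs = inj₂ (inj₁ y∈xs)
  ... | inj₂ y∈below = inj₂ (inj₂ y∈below)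

  members⊆vertices : ∀ segs {x} → x ∈ members segs → x ∈ vertices segs
  members⊆vertices ((a , xs) ∷ below) x∈ with ∈-++⁻ xs x∈
  ... | inj₁ x∈xs = member∈ {a} {xs} {below} x∈xs
  ... | inj₂ x∈below = below∈ {a} {xs} (members⊆vertices below x∈below)

  segment-transport : ∀ {pre pre' low low' traversed traversed' a xs below} →
    (∀ {y} → y ∈ vertices ((a , xs) ∷ below) → pre' y ≡ pre y) →
    (∀ {y} → y ∈ vertices ((a , xs) ∷ below) → low' y ≡ low y) →
    (∀ e → traversed e ≡ true → traversed' e ≡ true) →
    SegmentInvariant pre low traversed a xs below → SegmentInvariant pre' low' traversed' a xs below
  segment-transport {pre} {pre'} {low} {low'} {a = a} {xs} {below} pre≡ low≡ grows inv = record
    { owner<member = λ x∈ → subst₂ _<_ (sym (pre≡ (here refl))) (sym (pre≡ (member∈' x∈))) (owner<member x∈)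
    ; below<owner = λ y∈ → subst₂ _<_ (sym (pre≡ (below∈' y∈))) (sym (pre≡ (here refl))) (below<owner y∈)
    ; low-owner = let l , low≡l , l≤ = low-owner in
        l , trans (low≡ (here refl)) low≡l , subst (l ≤_) (sym (pre≡ (here refl))) l≤
    ; low-member = λ x∈ → let l , low≡x , l< , owner≤ = low-member x∈ in
        l , trans (low≡ (member∈' x∈)) low≡x , subst (l <_) (sym (pre≡ (member∈' x∈))) l<
          , subst (_≤∞ fin l) (sym (low≡ (here refl))) owner≤
    ; member↔owner = member↔owner
    ; low-witness = λ y∈ → let z , z∈ , low≡z , y→z = low-witness y∈ in
        z , z∈ , trans (low≡ (owner-or-member y∈)) (trans low≡z (cong fin (sym (pre≡ z∈)))) , y→z
    ; member-finished = λ x∈ e tail≡ → grows e (member-finished x∈ e tail≡)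
    }
    where
    open SegmentInvariant inv
    member∈' : ∀ {x} → x ∈ xs → x ∈ vertices ((a , xs) ∷ below)
    member∈' = member∈ {a} {xs} {below}
    below∈' : ∀ {y} → y ∈ vertices below → y ∈ vertices ((a , xs) ∷ below)
    below∈' = below∈ {a} {xs} {below}
    owner-or-member : ∀ {y} → y ∈ a ∷ xs → y ∈ vertices ((a , xs) ∷ below)
    owner-or-member (here y≡a) = here y≡a
    owner-or-member (there y∈xs) = member∈' y∈xs

  segments-transport : ∀ {pre pre' low low' traversed traversed'} segs →
    (∀ {y} → y ∈ vertices segs → pre' y ≡ pre y) →
    (∀ {y} → y ∈ vertices segs → low' y ≡ low y) →
    (∀ e → traversed e ≡ true → traversed' e ≡ true) →
    SegmentsInvariant pre low traversed segs → SegmentsInvariant pre' low' traversed' segs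
  segments-transport [] pre≡ low≡ grows _ = tt
  segments-transport ((a , xs) ∷ below) pre≡ low≡ grows (inv , invs) =
    segment-transport pre≡ low≡ grows inv ,
    segments-transport below (λ y∈ → pre≡ (below∈ {a} {xs} y∈)) (λ y∈ → low≡ (below∈ {a} {xs} y∈)) grows invs

  treePath-transport : ∀ {treeIn treeIn'} segs → (∀ {y} → y ∈ vertices segs → treeIn' y ≡ treeIn y) →
                       TreePath treeIn segs → TreePath treeIn' segs
  treePath-transport [] _ _ = tt
  treePath-transport ((a , xs) ∷ []) treeIn≡ path = trans (treeIn≡ (here refl)) path
  treePath-transport ((a , xs) ∷ (b , ys) ∷ below) treeIn≡ ((e , in≡ , tail≡ , tip≡) , path) =
    (e , trans (treeIn≡ (here refl)) in≡ , tail≡ , tip≡) ,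
    treePath-transport ((b , ys) ∷ below) (λ y∈ → treeIn≡ (below∈ {a} {xs} {(b , ys) ∷ below} y∈)) path

  treePath-members : ∀ {treeIn a xs ys} below → TreePath treeIn ((a , xs) ∷ below) → TreePath treeIn ((a , ys) ∷ below)
  treePath-members [] path = path
  treePath-members (_ ∷ _) path = path

  treePath-below : ∀ {treeIn a xs} below → TreePath treeIn ((a , xs) ∷ below) → TreePath treeIn below
  treePath-below [] _ = tt
  treePath-below (_ ∷ _) (_ , path) = path

  low≤pre : ∀ {pre low traversed} segs → SegmentsInvariant pre low traversed segs →
            ∀ {y} → y ∈ vertices segs → ∃[ l ] (low y ≡ fin l × l ≤ pre y)
  low≤pre ((a , xs) ∷ below) (inv , invs) y∈ with ∈vertices⁻ y∈
  ... | inj₁ refl = SegmentInvariant.low-owner inv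
  ... | inj₂ (inj₁ y∈xs) = let l , low≡ , l< , _ = SegmentInvariant.low-member inv y∈xs in l , low≡ , <⇒≤ l<
  ... | inj₂ (inj₂ y∈below) = low≤pre below invs y∈below

  member-low<pre : ∀ {pre low traversed} segs → SegmentsInvariant pre low traversed segs →
                   ∀ {y} → y ∈ members segs → ∃[ l ] (low y ≡ fin l × l < pre y)
  member-low<pre ((a , xs) ∷ below) (inv , invs) y∈ with ∈-++⁻ xs y∈
  ... | inj₁ y∈xs = let l , low≡ , l< , _ = SegmentInvariant.low-member inv y∈xs in l , low≡ , l<
  ... | inj₂ y∈below = member-low<pre below invs y∈below

  reach-owner : ∀ {pre low traversed treeIn} a xs below →
                SegmentsInvariant pre low traversed ((a , xs) ∷ below) → TreePath treeIn ((a , xs) ∷ below) →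
                ∀ {y} → y ∈ vertices ((a , xs) ∷ below) → Reach G y a
  reach-owner a xs below (inv , invs) path y∈ with ∈vertices⁻ y∈
  ... | inj₁ refl = here
  ... | inj₂ (inj₁ y∈xs) = proj₁ (SegmentInvariant.member↔owner inv y∈xs)
  reach-owner a xs ((b , ys) ∷ below) (inv , invs) ((e , _ , tail≡ , tip≡) , path) y∈ | inj₂ (inj₂ y∈below) =
    reach-owner b ys below invs path y∈below ◅◅ arc⇒Reach e tail≡ tip≡

  low-witness-vertices : ∀ {pre low traversed} segs → SegmentsInvariant pre low traversed segs →
                         ∀ {y} → y ∈ vertices segs → ∃[ z ] (z ∈ vertices segs × low y ≡ fin (pre z) × Reach G y z)
  low-witness-vertices ((a , xs) ∷ below) (inv , invs) y∈ with ∈vertices⁻ y∈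
  ... | inj₁ refl = SegmentInvariant.low-witness inv (here refl)
  ... | inj₂ (inj₁ y∈xs) = SegmentInvariant.low-witness inv (there y∈xs)
  ... | inj₂ (inj₂ y∈below) =
    let z , z∈ , low≡ , y→z = low-witness-vertices below invs y∈below in z , below∈ {a} {xs} z∈ , low≡ , y→z

  length-members≤length-vertices : ∀ segs → length (members segs) ≤ length (vertices segs)
  length-members≤length-vertices [] = z≤n
  length-members≤length-vertices ((a , xs) ∷ below)
    rewrite length-++ xs {members below} | length-++ xs {vertices below} =
    m≤n⇒m≤1+n (+-monoʳ-≤ (length xs) (length-members≤length-vertices below))

  unvisited∉ : ∀ {visited : V → Bool} {ys : List V} {w} →
               (∀ {y} → y ∈ ys → visited y ≡ true) → visited w ≡ false → w ∉ ys
  unvisited∉ all-visited w-unvisited w∈ = case trans (sym (all-visited w∈)) w-unvisited of λ ()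

  idle⇒no-segments : ∀ {s segs} → Invariant s segs → current s ≡ nothing → segs ≡ []
  idle⇒no-segments {segs = []} _ _ = refl
  idle⇒no-segments {segs = _ ∷ _} I idle = case trans (sym idle) (Invariant.current≡top I) of λ ()

  current⇒top-segment : ∀ {s segs v} → Invariant s segs → current s ≡ just v →
                        ∃[ xs ] ∃[ below ] (segs ≡ (v , xs) ∷ below)
  current⇒top-segment {segs = []} I current≡v = case trans (sym current≡v) (Invariant.current≡top I) of λ ()
  current⇒top-segment {segs = (a , xs) ∷ below} I current≡v =
    xs , below , cong (λ v → (v , xs) ∷ below) (sym (just-injective (trans (sym current≡v) (Invariant.current≡top I))))

  module _ {s : State G} {segs : List Segment} (I : Invariant s segs) where
    open Invariant I

    exploring-invariant : phase s ≡ explore → SegmentsInvariant (pre s) (low s) (traversed s) segs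
    exploring-invariant explore≡ = subst (λ p → PhaseInvariant (pre s) (low s) (traversed s) p segs) explore≡ phase-invariant

    popping-invariant : ∀ {v S} → phase s ≡ popping v S → PhaseInvariant (pre s) (low s) (traversed s) (popping v S) segs
    popping-invariant popping≡ = subst (λ p → PhaseInvariant (pre s) (low s) (traversed s) p segs) popping≡ phase-invariant

    exploring⇒assigned≡outputs : phase s ≡ explore → assigned s ≡ concat (outputs s)
    exploring⇒assigned≡outputs explore≡ = cong (λ p → popped p ++ concat (outputs s)) explore≡

    potential≤ : potential s segs ≤ m G + 5 * n G + 1
    potential≤ = begin
      potential s segs               ≤⟨ bounds ⟩
      m G + n G + 3 * n G + n G + 1  ≡⟨ collect (m G) (n G) ⟩
      m G + 5 * n G + 1              ∎
      where
      open ≤-Reasoning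
      path+assigned≤n : length (vertices segs) + length (assigned s) ≤ n G
      path+assigned≤n = subst (_≤ n G) (length-++ (vertices segs) {assigned s})
                              (Distinct⇒length≤ (vertices segs ++ assigned s) distinct)
      flag≤1 : ∀ p → poppingFlag p ≤ 1
      flag≤1 explore = z≤n
      flag≤1 (popping _ _) = ≤-refl
      path≤n : length (vertices segs) ≤ n G
      path≤n = ≤-trans (m≤m+n _ _) path+assigned≤n
      assigned≤n : length (assigned s) ≤ n G
      assigned≤n = ≤-trans (m≤n+m _ _) path+assigned≤n
      bounds : potential s segs ≤ m G + n G + 3 * n G + n G + 1
      bounds = +-mono-≤ (+-mono-≤ (+-mono-≤ (+-mono-≤ (trueCount≤ (traversed s)) path≤n)
                 (*-monoʳ-≤ 3 assigned≤n))
                 (subst (λ f → length f ≤ n G) (sym F≡members) (≤-trans (length-members≤length-vertices segs) path≤n)))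
                 (flag≤1 (phase s))
      collect : ∀ a b → a + b + 3 * b + b + 1 ≡ a + 5 * b + 1
      collect = solve-∀

  initial-invariant : Invariant (initial G) []
  initial-invariant = record
    { current≡top = refl ; F≡members = refl ; treePath = tt ; phase-invariant = tt
    ; vertices-visited = λ () ; assigned-visited = λ () ; pre≤counter = λ ()
    ; traversed⇒tip-visited = λ _ () ; traversed⇒tail-visited = λ _ () ; visited⇒located = λ _ ()
    ; assigned-low∞ = λ () ; traversed-low≤pre = λ _ () ; distinct = λ _ → z≤n ; outputs-components = λ () }

  -- Terminal states

  popping-can-step : ∀ s {v S} → phase s ≡ popping v S → ∃[ s' ] Step G s s'
  popping-can-step s {v} {S} popping≡ with F s in F≡
  ... | [] = _ , pop-done s v S popping≡ (λ _ _ F≡x∷ → case trans (sym F≡) F≡x∷ of λ ())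
  ... | x ∷ F' with low s v ≤∞? low s x
  ...   | yes v≤x = _ , pop s v S x F' popping≡ F≡ v≤x
  ...   | no v≰x = _ , pop-done s v S popping≡ (λ _ _ F≡y∷ →
    subst (λ y → ¬ (low s v ≤∞ low s y)) (proj₁ (∷-injective (trans (sym F≡) F≡y∷))) v≰x)

  postvisit-can-step : ∀ s {v} → phase s ≡ explore → current s ≡ just v →
                       (∀ a → tail G a ≡ v → traversed s a ≡ true) → ∃[ s' ] Step G s s'
  postvisit-can-step s {v} explore≡ current≡ finished with low s v ≟∞ fin (pre s v)
  ... | yes low≡pre = _ , postvisit-root s v explore≡ current≡ finished low≡pre
  ... | no low≢pre = _ , postvisit-push s v explore≡ current≡ finished low≢pre

  current-can-step : ∀ s {v} → phase s ≡ explore → current s ≡ just v → ∃[ s' ] Step G s s'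
  current-can-step s {v} explore≡ current≡
    with any? (λ a → (tail G a ≟ v) ×-dec (traversed s a Data.Bool.≟ false))
  ... | no none-left = postvisit-can-step s explore≡ current≡
                         (λ a tail≡ → ¬-not (λ untraversed → none-left (a , tail≡ , untraversed)))
  ... | yes (a , tail≡ , untraversed) with visited s (tip G a) in visited≡
  ...   | true = _ , advance-visited s v a explore≡ current≡ tail≡ untraversed visited≡
  ...   | false = _ , advance-tree s v a explore≡ current≡ tail≡ untraversed visited≡

  Terminal⇒finished : ∀ s → Terminal G s → phase s ≡ explore × current s ≡ nothing × (∀ v → visited s v ≡ true)
  Terminal⇒finished s terminal with phase s in phase≡
  ... | popping v S = ⊥-elim (terminal (popping-can-step s phase≡))
  ... | explore with current s in current≡
  ...   | just v = ⊥-elim (terminal (current-can-step s phase≡ current≡))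
  ...   | nothing = refl , refl , λ v → ¬-not (λ unvisited → terminal (_ , start s v phase≡ current≡ unvisited))

  terminal⇒partition : ∀ {s segs} → Invariant s segs → Terminal G s → IsSCCPartition G (outputs s)
  terminal⇒partition {s} I terminal with Terminal⇒finished s terminal
  ... | explore≡ , idle , all-visited with idle⇒no-segments I idle
  ... | refl = (λ _ O∈ → IsComponent.nonempty (outputs-components O∈)) , covered , same-output⇔mutual
    where
    open Invariant I
    assigned≡ : assigned s ≡ concat (outputs s)
    assigned≡ = exploring⇒assigned≡outputs I explore≡
    covered : ∀ v → ∃[ S ] v ∈ S × S ∈ outputs s
    covered v with visited⇒located v (all-visited v)
    ... | inj₂ v∈assigned = ∈-concat⁻′ (outputs s) (subst (v ∈_) assigned≡ v∈assigned)
    same-output⇔mutual : ∀ {S T u w} (p : S ∈ outputs s) (q : T ∈ outputs s) → u ∈ S → w ∈ T →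
                         (index p ≡ index q → MutuallyReachable G u w) × (MutuallyReachable G u w → index p ≡ index q)
    same-output⇔mutual {u = u} {w} p q u∈S w∈T = same⇒mutual , mutual⇒same
      where
      same⇒mutual : index p ≡ index q → MutuallyReachable G u w
      same⇒mutual i≡j with index-injective p q i≡j
      ... | refl = IsComponent.connected (outputs-components p) u∈S w∈T ,
                   IsComponent.connected (outputs-components p) w∈T u∈S
      mutual⇒same : MutuallyReachable G u w → index p ≡ index q
      mutual⇒same (u→w , w→u) =
        Distinct-concat⇒index≡ (outputs s) p q (IsComponent.closed (outputs-components p) u∈S u→w w→u) w∈T
          (subst Distinct assigned≡ distinct)

  -- Each step preserves the invariant and raises the potential

  fresh-segment : ∀ (s : State G) w t {traversed'} below →
    (∀ {y} → y ∈ vertices below → w ≢ y) → (∀ {y} → y ∈ vertices below → pre s y ≤ counter s) →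
    SegmentInvariant (pre (previsit w t s)) (low (previsit w t s)) traversed' w [] below
  fresh-segment s w t below w∉below pre≤ = record
    { owner<member = λ ()
    ; below<owner = λ y∈ → subst₂ _<_ (sym (update-≢ (pre s) _ (w∉below y∈))) (sym (update-≡ (pre s) w _)) (s≤s (pre≤ y∈))
    ; low-owner = suc (counter s) , update-≡ (low s) w _ , ≤-reflexive (sym (update-≡ (pre s) w _))
    ; low-member = λ ()
    ; member↔owner = λ ()
    ; low-witness = λ { (here refl) → w , here refl , trans (update-≡ (low s) w _) (cong fin (sym (update-≡ (pre s) w _))) , here }
    ; member-finished = λ ()
    }

  start-progress : ∀ s v → phase s ≡ explore → current s ≡ nothing → visited s v ≡ false →
                   Progress s (previsit v nothing s)
  start-progress s v explore≡ idle v-unvisited I with idle⇒no-segments I idle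
  ... | refl = ((v , []) ∷ []) , I' , ≤-reflexive (sym gain)
    where
    open Invariant I
    s' = previsit v nothing s
    v∉assigned : v ∉ assigned s
    v∉assigned = unvisited∉ assigned-visited v-unvisited
    v≢assigned : ∀ {y} → y ∈ assigned s → v ≢ y
    v≢assigned y∈ refl = v∉assigned y∈
    no-traversed-arc-from-v : ∀ e → tail G e ≡ v → traversed s e ≡ true → ⊥
    no-traversed-arc-from-v e refl traversed≡ = case trans (sym (traversed⇒tail-visited e traversed≡)) v-unvisited of λ ()
    located : ∀ y → visited s' y ≡ true → y ∈ v ∷ [] ⊎ y ∈ assigned s
    located y visited≡ with update-true⁻ (visited s) v visited≡
    ... | inj₁ refl = inj₁ (here refl)
    ... | inj₂ visited-before with visited⇒located y visited-before
    ...   | inj₂ y∈assigned = inj₂ y∈assigned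
    I' : Invariant s' ((v , []) ∷ [])
    I' = record
      { current≡top = refl
      ; F≡members = F≡members
      ; treePath = update-≡ (treeIn s) v nothing
      ; phase-invariant = subst (λ p → PhaseInvariant (pre s') (low s') (traversed s') p _) (sym explore≡)
                            (fresh-segment s v nothing [] (λ ()) (λ ()) , tt)
      ; vertices-visited = λ { (here refl) → update-≡ (visited s) v true ; (there ()) }
      ; assigned-visited = λ y∈ → update-true (visited s) v (assigned-visited y∈)
      ; pre≤counter = λ { (here refl) → ≤-reflexive (update-≡ (pre s) v _) ; (there ()) }
      ; traversed⇒tip-visited = λ e traversed≡ → update-true (visited s) v (traversed⇒tip-visited e traversed≡)
      ; traversed⇒tail-visited = λ e traversed≡ → update-true (visited s) v (traversed⇒tail-visited e traversed≡)
      ; visited⇒located = located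
      ; assigned-low∞ = λ y∈ → trans (update-≢ (low s) _ (v≢assigned y∈)) (assigned-low∞ y∈)
      ; traversed-low≤pre = λ { e (here refl) _ tail≡ _ traversed≡ → ⊥-elim (no-traversed-arc-from-v e tail≡ traversed≡)
                              ; e (there ()) }
      ; distinct = Distinct-∷⁺ v∉assigned distinct
      ; outputs-components = outputs-components
      }
    gain : potential s' ((v , []) ∷ []) ≡ suc (potential s [])
    gain = shuffle (trueCount (traversed s)) (3 * length (assigned s)) (length (F s)) (poppingFlag (phase s))
      where
      shuffle : ∀ t d f p → t + 1 + d + f + p ≡ suc (t + 0 + d + f + p)
      shuffle = solve-∀

  advance-tree-progress : ∀ s v a → phase s ≡ explore → current s ≡ just v → tail G a ≡ v →
    traversed s a ≡ false → visited s (tip G a) ≡ false →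
    Progress s (previsit (tip G a) (just a) (record s { traversed = update (traversed s) a true }))
  advance-tree-progress s v a explore≡ current≡ tail≡ untraversed w-unvisited I
    with current⇒top-segment I current≡
  ... | xs , below , refl = ((w , []) ∷ segs) , I' , ≤-trans (n≤1+n _) (≤-reflexive (sym gain))
    where
    open Invariant I
    w = tip G a
    segs = (v , xs) ∷ below
    s' = previsit w (just a) (record s { traversed = update (traversed s) a true })
    w∉segs : w ∉ vertices segs
    w∉segs = unvisited∉ vertices-visited w-unvisited
    w∉assigned : w ∉ assigned s
    w∉assigned = unvisited∉ assigned-visited w-unvisited
    w≢segs : ∀ {y} → y ∈ vertices segs → w ≢ y
    w≢segs y∈ refl = w∉segs y∈
    pre-kept : ∀ {y} → y ∈ vertices segs → pre s' y ≡ pre s y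
    pre-kept y∈ = update-≢ (pre s) _ (w≢segs y∈)
    low-kept : ∀ {y} → y ∈ vertices segs → low s' y ≡ low s y
    low-kept y∈ = update-≢ (low s) _ (w≢segs y∈)
    traversed-grows : ∀ e → traversed s e ≡ true → traversed s' e ≡ true
    traversed-grows e = update-true (traversed s) a
    ∈new⁻ : ∀ {y} → y ∈ w ∷ vertices segs → y ≡ w ⊎ y ∈ vertices segs
    ∈new⁻ (here y≡w) = inj₁ y≡w
    ∈new⁻ (there y∈) = inj₂ y∈
    visited-old : ∀ {y} → y ∈ w ∷ vertices segs → visited s y ≡ true → y ∈ vertices segs
    visited-old y∈ visited≡ with ∈new⁻ y∈
    ... | inj₁ refl = case trans (sym visited≡) w-unvisited of λ ()
    ... | inj₂ y∈segs = y∈segs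
    low≤pre-new : ∀ {y t} e → y ∈ w ∷ vertices segs → t ∈ w ∷ vertices segs → tail G e ≡ y → tip G e ≡ t →
                  traversed s' e ≡ true → low s' y ≤∞ fin (pre s' t)
    low≤pre-new e y∈ t∈ refl refl traversed≡ with update-true⁻ (traversed s) a traversed≡
    ... | inj₁ refl with low≤pre segs (exploring-invariant I explore≡) (here refl)
    ...   | l , low≡ , l≤pre rewrite tail≡ =
      subst₂ (λ low' pre' → low' ≤∞ fin pre') (sym (trans (low-kept (here refl)) low≡)) (sym (update-≡ (pre s) w _))
        (m≤n⇒m≤1+n (≤-trans l≤pre (pre≤counter (here refl))))
    low≤pre-new e y∈ t∈ refl refl traversed≡ | inj₂ traversed-before =
      let y∈segs = visited-old y∈ (traversed⇒tail-visited e traversed-before)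
          t∈segs = visited-old t∈ (traversed⇒tip-visited e traversed-before)
      in subst₂ (λ low' pre' → low' ≤∞ fin pre') (sym (low-kept y∈segs)) (sym (pre-kept t∈segs))
           (traversed-low≤pre e y∈segs t∈segs refl refl traversed-before)
    vertices-visited' : ∀ {y} → y ∈ w ∷ vertices segs → visited s' y ≡ true
    vertices-visited' (here refl) = update-≡ (visited s) w true
    vertices-visited' (there y∈) = update-true (visited s) w (vertices-visited y∈)
    pre≤counter' : ∀ {y} → y ∈ w ∷ vertices segs → pre s' y ≤ counter s'
    pre≤counter' (here refl) = ≤-reflexive (update-≡ (pre s) w _)
    pre≤counter' (there y∈) = subst (_≤ suc (counter s)) (sym (pre-kept y∈)) (m≤n⇒m≤1+n (pre≤counter y∈))
    tip-visited : ∀ e → traversed s' e ≡ true → visited s' (tip G e) ≡ true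
    tip-visited e traversed≡ with update-true⁻ (traversed s) a traversed≡
    ... | inj₁ refl = update-≡ (visited s) w true
    ... | inj₂ traversed-before = update-true (visited s) w (traversed⇒tip-visited e traversed-before)
    tail-visited : ∀ e → traversed s' e ≡ true → visited s' (tail G e) ≡ true
    tail-visited e traversed≡ with update-true⁻ (traversed s) a traversed≡
    ... | inj₁ refl = update-true (visited s) w (subst (λ u → visited s u ≡ true) (sym tail≡) (vertices-visited (here refl)))
    ... | inj₂ traversed-before = update-true (visited s) w (traversed⇒tail-visited e traversed-before)
    located : ∀ y → visited s' y ≡ true → y ∈ w ∷ vertices segs ⊎ y ∈ assigned s
    located y visited≡ with update-true⁻ (visited s) w visited≡
    ... | inj₁ refl = inj₁ (here refl)
    ... | inj₂ visited-before with visited⇒located y visited-before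
    ...   | inj₁ y∈segs = inj₁ (there y∈segs)
    ...   | inj₂ y∈assigned = inj₂ y∈assigned
    I' : Invariant s' ((w , []) ∷ segs)
    I' = record
      { current≡top = refl
      ; F≡members = F≡members
      ; treePath = (a , update-≡ (treeIn s) w (just a) , tail≡ , refl) ,
                   treePath-transport segs (λ y∈ → update-≢ (treeIn s) _ (w≢segs y∈)) treePath
      ; phase-invariant =
          subst (λ p → PhaseInvariant (pre s') (low s') (traversed s') p ((w , []) ∷ segs)) (sym explore≡)
          (fresh-segment s w (just a) segs w≢segs pre≤counter ,
           segments-transport segs pre-kept low-kept traversed-grows (exploring-invariant I explore≡))
      ; vertices-visited = vertices-visited'
      ; assigned-visited = λ y∈ → update-true (visited s) w (assigned-visited y∈)
      ; pre≤counter = pre≤counter'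
      ; traversed⇒tip-visited = tip-visited
      ; traversed⇒tail-visited = tail-visited
      ; visited⇒located = located
      ; assigned-low∞ = λ y∈ → trans (update-≢ (low s) {w} (fin (suc (counter s))) (λ { refl → w∉assigned y∈ })) (assigned-low∞ y∈)
      ; traversed-low≤pre = low≤pre-new
      ; distinct = Distinct-∷⁺ (λ w∈ → [ w∉segs , w∉assigned ]′ (∈-++⁻ (vertices segs) w∈)) distinct
      ; outputs-components = outputs-components
      }
    gain : potential s' ((w , []) ∷ segs) ≡ suc (suc (potential s segs))
    gain rewrite trueCount-update (traversed s) a untraversed =
      shuffle (trueCount (traversed s)) (length (vertices segs)) (3 * length (assigned s)) (length (F s)) (poppingFlag (phase s))
      where
      shuffle : ∀ t b d f p → suc t + suc b + d + f + p ≡ suc (suc (t + b + d + f + p))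
      shuffle = solve-∀

  lower-owner-low : ∀ {pre low traversed traversed' v xs below} → SegmentInvariant pre low traversed v xs below →
    v ∉ xs → (l' : ℕ∞) → l' ≤∞ low v →
    (∃[ z ] (z ∈ vertices ((v , xs) ∷ below) × l' ≡ fin (pre z) × Reach G v z)) →
    (∀ e → traversed e ≡ true → traversed' e ≡ true) →
    SegmentInvariant pre (update low v l') traversed' v xs below
  lower-owner-low {pre} {low} {v = v} {xs} inv v∉xs l' l'≤low (z , z∈ , l'≡ , v→z) grows = record
    { owner<member = owner<member
    ; below<owner = below<owner
    ; low-owner = pre z , trans (update-≡ low v l') l'≡ , proj₂ (proj₂ pre-z≤pre-v)
    ; low-member = λ x∈ → let l , low≡ , l< , owner≤ = low-member x∈ in
        l , trans (update-≢ low l' (v≢ x∈)) low≡ , l< ,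
        subst (_≤∞ fin l) (sym (update-≡ low v l')) (≤∞-trans l'≤low owner≤)
    ; member↔owner = member↔owner
    ; low-witness = λ
        { (here refl) → z , z∈ , trans (update-≡ low v l') l'≡ , v→z
        ; (there x∈) → let z' , z'∈ , low≡ , x→z' = low-witness (there x∈) in
            z' , z'∈ , trans (update-≢ low l' (v≢ x∈)) low≡ , x→z' }
    ; member-finished = λ x∈ e tail≡ → grows e (member-finished x∈ e tail≡)
    }
    where
    open SegmentInvariant inv
    v≢ : ∀ {x} → x ∈ xs → v ≢ x
    v≢ x∈ refl = v∉xs x∈
    pre-z≤pre-v : ∃[ l ] (fin (pre z) ≡ fin l × l ≤ pre v)
    pre-z≤pre-v = let l , low≡ , l≤ = low-owner in
      ≤∞fin⇒fin (subst (_≤∞ fin (pre v)) l'≡ (≤∞-trans l'≤low (subst (_≤∞ fin (pre v)) (sym low≡) l≤)))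

  advance-visited-progress : ∀ s v a → phase s ≡ explore → current s ≡ just v → tail G a ≡ v →
    traversed s a ≡ false → visited s (tip G a) ≡ true →
    Progress s (record s { traversed = update (traversed s) a true
                         ; low = update (low s) v (min∞ (low s v) (low s (tip G a))) })
  advance-visited-progress s v a explore≡ current≡ tail≡ untraversed t-visited I
    with current⇒top-segment I current≡
  ... | xs , below , refl = segs , I' , ≤-reflexive (sym gain)
    where
    open Invariant I
    t = tip G a
    l' = min∞ (low s v) (low s t)
    segs = (v , xs) ∷ below
    s' = record s { traversed = update (traversed s) a true ; low = update (low s) v l' }
    invs = exploring-invariant I explore≡
    traversed-grows : ∀ e → traversed s e ≡ true → traversed s' e ≡ true
    traversed-grows e = update-true (traversed s) a
    v∉xs : v ∉ xs
    v∉xs v∈ = Distinct-++⇒∉ (v ∷ []) distinct (here refl) (∈-++⁺ˡ (∈-++⁺ˡ v∈))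
    v∉below : v ∉ vertices below
    v∉below v∈ = Distinct-++⇒∉ (v ∷ []) distinct (here refl) (∈-++⁺ˡ (∈-++⁺ʳ xs v∈))
    v∉assigned : v ∉ assigned s
    v∉assigned = Distinct-++⇒∉ (vertices segs) distinct (here refl)
    l'≤low : ∀ y → low s' y ≤∞ low s y
    l'≤low y with v ≟ y
    ... | yes refl = min∞-≤ˡ (low s v) (low s t)
    ... | no _ = ≤∞-refl
    l'-witness : ∃[ z ] (z ∈ vertices segs × l' ≡ fin (pre s z) × Reach G v z)
    l'-witness with SegmentInvariant.low-witness (proj₁ invs) (here refl) | visited⇒located t t-visited
    ... | z , z∈ , low≡ , v→z | inj₂ t∈assigned =
      z , z∈ , trans (cong (min∞ (low s v)) (assigned-low∞ t∈assigned)) (trans (min∞-identityʳ (low s v)) low≡) , v→z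
    ... | z , z∈ , low≡ , v→z | inj₁ t∈segs =
      let z' , z'∈ , low≡' , t→z' = low-witness-vertices segs invs t∈segs
          z'' , l'≡ , z''∈ , v→z'' = min∞-witness (pre s) (λ z → z ∈ vertices segs × Reach G v z)
                                       low≡ (z∈ , v→z) low≡' (z'∈ , arc⇒Reach a tail≡ refl ◅◅ t→z')
      in z'' , z''∈ , l'≡ , v→z''
    low-kept-below : ∀ {y} → y ∈ vertices below → low s' y ≡ low s y
    low-kept-below y∈ = update-≢ (low s) {v} l' (λ { refl → v∉below y∈ })
    low≤pre-new : ∀ {y t'} e → y ∈ vertices segs → t' ∈ vertices segs → tail G e ≡ y → tip G e ≡ t' →
                  traversed s' e ≡ true → low s' y ≤∞ fin (pre s t')
    low≤pre-new e y∈ t'∈ refl refl traversed≡ with update-true⁻ (traversed s) a traversed≡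
    ... | inj₂ traversed-before = ≤∞-trans (l'≤low _) (traversed-low≤pre e y∈ t'∈ refl refl traversed-before)
    ... | inj₁ refl rewrite tail≡ | update-≡ (low s) v l' =
      let l , low≡ , l≤ = low≤pre segs invs t'∈ in
      ≤∞-trans (min∞-≤ʳ (low s v) (low s t)) (subst (_≤∞ fin (pre s t)) (sym low≡) l≤)
    I' : Invariant s' segs
    I' = record
      { current≡top = current≡top
      ; F≡members = F≡members
      ; treePath = treePath
      ; phase-invariant = subst (λ p → PhaseInvariant (pre s) (low s') (traversed s') p segs) (sym explore≡)
          (lower-owner-low (proj₁ invs) v∉xs l' (min∞-≤ˡ (low s v) (low s t)) l'-witness traversed-grows ,
           segments-transport below (λ _ → refl) low-kept-below traversed-grows (proj₂ invs))
      ; vertices-visited = vertices-visited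
      ; assigned-visited = assigned-visited
      ; pre≤counter = pre≤counter
      ; traversed⇒tip-visited = λ e traversed≡ →
          [ (λ { refl → t-visited }) , traversed⇒tip-visited e ]′ (update-true⁻ (traversed s) a traversed≡)
      ; traversed⇒tail-visited = λ e traversed≡ →
          [ (λ { refl → subst (λ u → visited s u ≡ true) (sym tail≡) (vertices-visited (here refl)) })
          , traversed⇒tail-visited e ]′ (update-true⁻ (traversed s) a traversed≡)
      ; visited⇒located = visited⇒located
      ; assigned-low∞ = λ y∈ → trans (update-≢ (low s) {v} l' (λ { refl → v∉assigned y∈ })) (assigned-low∞ y∈)
      ; traversed-low≤pre = low≤pre-new
      ; distinct = distinct
      ; outputs-components = outputs-components
      }
    gain : potential s' segs ≡ suc (potential s segs)
    gain rewrite trueCount-update (traversed s) a untraversed = refl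

  -- A path leaving the segment of v would cross a traversed arc into an
  -- output set, which is closed and so would contain v, or into a lower
  -- segment, whose preorder numbers lie below low v = pre v.
  root-segment-closed : ∀ {s v xs below} → Invariant s ((v , xs) ∷ below) → phase s ≡ explore →
    (∀ a → tail G a ≡ v → traversed s a ≡ true) → low s v ≡ fin (pre s v) →
    ∀ {y w} → y ≡ v ⊎ y ∈ xs → Reach G y w → Reach G w v → w ≡ v ⊎ w ∈ xs
  root-segment-closed {s} {v} {xs} {below} I explore≡ v-finished low≡pre = closed
    where
    open Invariant I
    inv = proj₁ (exploring-invariant I explore≡)
    assigned≡ = exploring⇒assigned≡outputs I explore≡
    v∉assigned : v ∉ assigned s
    v∉assigned = Distinct-++⇒∉ (vertices ((v , xs) ∷ below)) distinct (here refl)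
    pre≤low : ∀ {y} → y ≡ v ⊎ y ∈ xs → fin (pre s v) ≤∞ low s y
    pre≤low (inj₁ refl) = subst (fin (pre s v) ≤∞_) (sym low≡pre) ≤-refl
    pre≤low (inj₂ y∈xs) = let _ , low≡ , _ , owner≤ = SegmentInvariant.low-member inv y∈xs in
      subst₂ _≤∞_ low≡pre (sym low≡) owner≤
    in-segment : ∀ {y} → y ≡ v ⊎ y ∈ xs → y ∈ vertices ((v , xs) ∷ below)
    in-segment (inj₁ refl) = here refl
    in-segment (inj₂ y∈xs) = member∈ {v} {xs} {below} y∈xs
    v→y : ∀ {y} → y ≡ v ⊎ y ∈ xs → Reach G v y
    v→y (inj₁ refl) = here
    v→y (inj₂ y∈xs) = proj₂ (SegmentInvariant.member↔owner inv y∈xs)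
    finished : ∀ {y} → y ≡ v ⊎ y ∈ xs → ∀ e → tail G e ≡ y → traversed s e ≡ true
    finished (inj₁ refl) = v-finished
    finished (inj₂ y∈xs) = SegmentInvariant.member-finished inv y∈xs
    closed : ∀ {y w} → y ≡ v ⊎ y ∈ xs → Reach G y w → Reach G w v → w ≡ v ⊎ w ∈ xs
    closed y∈ here _ = y∈
    closed {y} y∈ (step e tail≡ tip→w) w→v
      with visited⇒located (tip G e) (traversed⇒tip-visited e (finished y∈ e tail≡))
    ... | inj₂ tip∈assigned =
      let O , tip∈O , O∈ = ∈-concat⁻′ (outputs s) (subst (tip G e ∈_) assigned≡ tip∈assigned)
          v∈O = IsComponent.closed (outputs-components O∈) tip∈O (tip→w ◅◅ w→v) (v→y y∈ ◅◅ arc⇒Reach e tail≡ refl)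
      in ⊥-elim (v∉assigned (subst (v ∈_) (sym assigned≡) (∈-concat⁺′ v∈O O∈)))
    ... | inj₁ tip∈segs with ∈vertices⁻ {v} {xs} {below} tip∈segs
    ...   | inj₁ tip≡v = closed (inj₁ tip≡v) tip→w w→v
    ...   | inj₂ (inj₁ tip∈xs) = closed (inj₂ tip∈xs) tip→w w→v
    ...   | inj₂ (inj₂ tip∈below) = ⊥-elim (<⇒≱ (SegmentInvariant.below<owner inv tip∈below)
            (≤∞-trans (pre≤low y∈) (traversed-low≤pre e (in-segment y∈) tip∈segs tail≡ refl (finished y∈ e tail≡))))

  postvisit-root-progress : ∀ s v → phase s ≡ explore → current s ≡ just v →
    (∀ a → tail G a ≡ v → traversed s a ≡ true) → low s v ≡ fin (pre s v) →
    Progress s (record s { phase = popping v [] })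
  postvisit-root-progress s v explore≡ current≡ v-finished low≡pre I
    with current⇒top-segment I current≡
  ... | xs , below , refl = segs , I' , ≤-reflexive (sym gain)
    where
    open Invariant I
    segs = (v , xs) ∷ below
    s' = record s { phase = popping v [] }
    invs = exploring-invariant I explore≡
    inv = proj₁ invs
    assigned≡ : assigned s' ≡ assigned s
    assigned≡ = sym (exploring⇒assigned≡outputs I explore≡)
    popping-inv : PoppingInvariant (pre s) (low s) v xs below
    popping-inv = record
      { low-root = low≡pre
      ; low-member = λ x∈ → let l , low≡ , _ , owner≤ = SegmentInvariant.low-member inv x∈ in
          l , low≡ , subst (_≤∞ fin l) low≡pre owner≤
      ; member↔root = SegmentInvariant.member↔owner inv
      ; below<root = SegmentInvariant.below<owner inv
      }
    component-so-far : ∀ w → MutuallyReachable G v w → w ≡ v ⊎ w ∈ xs ⊎ w ∈ []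
    component-so-far w (v→w , w→v) with root-segment-closed I explore≡ v-finished low≡pre (inj₁ refl) v→w w→v
    ... | inj₁ w≡v = inj₁ w≡v
    ... | inj₂ w∈xs = inj₂ (inj₁ w∈xs)
    I' : Invariant s' segs
    I' = record
      { current≡top = current≡top
      ; F≡members = F≡members
      ; treePath = treePath
      ; phase-invariant = xs , below , refl , popping-inv , proj₂ invs , (λ ()) , component-so-far
      ; vertices-visited = vertices-visited
      ; assigned-visited = λ y∈ → assigned-visited (subst (_ ∈_) assigned≡ y∈)
      ; pre≤counter = pre≤counter
      ; traversed⇒tip-visited = traversed⇒tip-visited
      ; traversed⇒tail-visited = traversed⇒tail-visited
      ; visited⇒located = λ y visited≡ → subst (λ A → y ∈ vertices segs ⊎ y ∈ A) (sym assigned≡) (visited⇒located y visited≡)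
      ; assigned-low∞ = λ y∈ → assigned-low∞ (subst (_ ∈_) assigned≡ y∈)
      ; traversed-low≤pre = traversed-low≤pre
      ; distinct = subst (λ A → Distinct (vertices segs ++ A)) (sym assigned≡) distinct
      ; outputs-components = outputs-components
      }
    gain : potential s' segs ≡ suc (potential s segs)
    gain = trans (+-comm _ 1) (cong suc (trans (sym (+-identityʳ _))
      (cong₂ (λ A p → trueCount (traversed s) + length (vertices segs) + 3 * length A + length (F s) + p)
             assigned≡ (cong poppingFlag (sym explore≡)))))

  low-witness-below : ∀ {pre low traversed v xs below} → SegmentInvariant pre low traversed v xs below →
                      ¬ (low v ≡ fin (pre v)) → ∃[ z ] (z ∈ vertices below × Reach G v z)
  low-witness-below {pre} {low} {v = v} {xs} {below} inv low≢pre with SegmentInvariant.low-witness inv (here refl)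
  ... | z , z∈ , low≡ , v→z with ∈vertices⁻ {v} {xs} {below} z∈
  ...   | inj₁ refl = ⊥-elim (low≢pre low≡)
  ...   | inj₂ (inj₂ z∈below) = z , z∈below , v→z
  ...   | inj₂ (inj₁ z∈xs) = ⊥-elim (<⇒≱ (SegmentInvariant.owner<member inv z∈xs) pre-z≤pre-v)
    where
    pre-z≤pre-v : pre z ≤ pre v
    pre-z≤pre-v with SegmentInvariant.low-owner inv
    ... | l , low≡l , l≤ with trans (sym low≡) low≡l
    ...   | refl = l≤

  merge-↭ : ∀ u v xs ys below →
            vertices ((u , v ∷ xs ++ ys) ∷ below) ↭ vertices ((v , xs) ∷ (u , ys) ∷ below)
  merge-↭ u v xs ys below = ↭-trans (swap u v ↭-refl) (prep v (↭-trans
    (↭-reflexive (cong (u ∷_) (++-assoc xs ys (vertices below))))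
    (↭-sym (shift u xs (ys ++ vertices below)))))

  merged-segment : ∀ {pre low low' traversed v xs u ys below} →
    SegmentInvariant pre low traversed v xs ((u , ys) ∷ below) → SegmentInvariant pre low traversed u ys below →
    (∀ e → tail G e ≡ v → traversed e ≡ true) → ¬ (low v ≡ fin (pre v)) → Reach G v u → Reach G u v →
    low' u ≡ min∞ (low u) (low v) → (∀ {y} → y ∈ v ∷ xs ++ ys → low' y ≡ low y) →
    SegmentInvariant pre low' traversed u (v ∷ xs ++ ys) below
  merged-segment {pre} {low} {low'} {traversed} {v} {xs} {u} {ys} {below} inv-v inv-u v-finished low≢pre v→u u→v low'-u low-kept =
    record
    { owner<member = owner<member'
    ; below<owner = V.below<owner
    ; low-owner = ≤∞fin⇒fin (≤∞-trans low'u≤low-u (lowU≤preU))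
    ; low-member = low-member'
    ; member↔owner = member↔owner'
    ; low-witness = low-witness'
    ; member-finished = member-finished'
    }
    where
    module V = SegmentInvariant inv-u
    module W = SegmentInvariant inv-v
    old⇒new : ∀ {y} → y ∈ vertices ((v , xs) ∷ (u , ys) ∷ below) → y ∈ vertices ((u , v ∷ xs ++ ys) ∷ below)
    old⇒new = ∈-resp-↭ (↭-sym (merge-↭ u v xs ys below))
    pre-u<pre-v : pre u < pre v
    pre-u<pre-v = W.below<owner (here refl)
    low'u≤low-u : low' u ≤∞ low u
    low'u≤low-u = subst (_≤∞ low u) (sym low'-u) (min∞-≤ˡ (low u) (low v))
    low'u≤low-v : low' u ≤∞ low v
    low'u≤low-v = subst (_≤∞ low v) (sym low'-u) (min∞-≤ʳ (low u) (low v))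
    lowU≤preU : low u ≤∞ fin (pre u)
    lowU≤preU = let l , low≡ , l≤ = V.low-owner in subst (_≤∞ fin (pre u)) (sym low≡) l≤
    low-v<pre-v : ∃[ l ] (low v ≡ fin l × l < pre v)
    low-v<pre-v = let l , low≡ , l≤ = W.low-owner in
      l , low≡ , ≤∧≢⇒< l≤ (λ l≡pre → low≢pre (trans low≡ (cong fin l≡pre)))
    owner<member' : ∀ {x} → x ∈ v ∷ xs ++ ys → pre u < pre x
    owner<member' (here refl) = pre-u<pre-v
    owner<member' (there x∈) = [ (λ x∈xs → <-trans pre-u<pre-v (W.owner<member x∈xs)) , V.owner<member ]′ (∈-++⁻ xs x∈)
    low-member' : ∀ {x} → x ∈ v ∷ xs ++ ys → ∃[ l ] (low' x ≡ fin l × l < pre x × low' u ≤∞ fin l)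
    low-member' (here refl) = let l , low≡ , l< = low-v<pre-v in
      l , trans (low-kept (here refl)) low≡ , l< , subst (low' u ≤∞_) low≡ low'u≤low-v
    low-member' (there x∈) with ∈-++⁻ xs x∈
    ... | inj₁ x∈xs = let l , low≡ , l< , v≤ = W.low-member x∈xs in
      l , trans (low-kept (there x∈)) low≡ , l< , ≤∞-trans low'u≤low-v v≤
    ... | inj₂ x∈ys = let l , low≡ , l< , u≤ = V.low-member x∈ys in
      l , trans (low-kept (there x∈)) low≡ , l< , ≤∞-trans low'u≤low-u u≤
    member↔owner' : ∀ {x} → x ∈ v ∷ xs ++ ys → Reach G x u × Reach G u x
    member↔owner' (here refl) = v→u , u→v
    member↔owner' (there x∈) with ∈-++⁻ xs x∈
    ... | inj₁ x∈xs = let x→v , v→x = W.member↔owner x∈xs in x→v ◅◅ v→u , u→v ◅◅ v→x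
    ... | inj₂ x∈ys = V.member↔owner x∈ys
    low-witness' : ∀ {y} → y ∈ u ∷ v ∷ xs ++ ys →
                   ∃[ z ] (z ∈ vertices ((u , v ∷ xs ++ ys) ∷ below) × low' y ≡ fin (pre z) × Reach G y z)
    low-witness' (here refl) =
      let zu , zu∈ , low≡u , u→zu = V.low-witness (here refl)
          zv , zv∈ , low≡v , v→zv = W.low-witness (here refl)
          z , min≡ , z∈ , u→z = min∞-witness pre (λ z → z ∈ vertices ((u , v ∷ xs ++ ys) ∷ below) × Reach G u z)
                                  low≡u (old⇒new (below∈ {v} {xs} {(u , ys) ∷ below} zu∈) , u→zu) low≡v (old⇒new zv∈ , u→v ◅◅ v→zv)
      in z , z∈ , trans low'-u min≡ , u→z
    low-witness' (there (here refl)) = let z , z∈ , low≡ , v→z = W.low-witness (here refl) in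
      z , old⇒new z∈ , trans (low-kept (here refl)) low≡ , v→z
    low-witness' (there (there x∈)) with ∈-++⁻ xs x∈
    ... | inj₁ x∈xs = let z , z∈ , low≡ , x→z = W.low-witness (there x∈xs) in
      z , old⇒new z∈ , trans (low-kept (there x∈)) low≡ , x→z
    ... | inj₂ x∈ys = let z , z∈ , low≡ , x→z = V.low-witness (there x∈ys) in
      z , old⇒new (below∈ {v} {xs} {(u , ys) ∷ below} z∈) , trans (low-kept (there x∈)) low≡ , x→z
    member-finished' : ∀ {x} → x ∈ v ∷ xs ++ ys → ∀ e → tail G e ≡ x → traversed e ≡ true
    member-finished' (here refl) = v-finished
    member-finished' (there x∈) = [ W.member-finished , V.member-finished ]′ (∈-++⁻ xs x∈)

  leave-root : ∀ (s : State G) v → treeIn s v ≡ nothing → leave v s ≡ record s { current = nothing }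
  leave-root s v in≡ with treeIn s v
  leave-root s v refl | .nothing = refl

  leave-child : ∀ (s : State G) v e → treeIn s v ≡ just e →
    leave v s ≡ record s { current = just (tail G e)
                         ; low = update (low s) (tail G e) (min∞ (low s (tail G e)) (low s v)) }
  leave-child s v e in≡ with treeIn s v
  leave-child s v e refl | .(just e) = refl

  postvisit-push-progress : ∀ s v → phase s ≡ explore → current s ≡ just v →
    (∀ a → tail G a ≡ v → traversed s a ≡ true) → ¬ (low s v ≡ fin (pre s v)) →
    Progress s (leave v (record s { F = v ∷ F s }))
  postvisit-push-progress s v explore≡ current≡ v-finished low≢pre I
    with current⇒top-segment I current≡
  ... | xs , [] , refl = case low-witness-below (proj₁ (exploring-invariant I explore≡)) low≢pre of λ { (_ , () , _) }
  ... | xs , (u , ys) ∷ below , refl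
    with low-witness-below (proj₁ (exploring-invariant I explore≡)) low≢pre | Invariant.treePath I
  ... | z , z∈below , v→z | (e , in≡ , refl , tip≡) , path-below =
    subst (Improves s segs) (sym (leave-child (record s { F = v ∷ F s }) v e in≡)) (segs' , I' , ≤-reflexive (sym gain))
    where
    open Invariant I
    segs = (v , xs) ∷ (u , ys) ∷ below
    segs' = (u , v ∷ xs ++ ys) ∷ below
    l' = min∞ (low s u) (low s v)
    s' = record s { F = v ∷ F s ; current = just u ; low = update (low s) u l' }
    invs = exploring-invariant I explore≡
    new↭old : vertices segs' ↭ vertices segs
    new↭old = merge-↭ u v xs ys below
    distinct' : Distinct (vertices segs' ++ assigned s)
    distinct' = Distinct-resp-↭ (++⁺ʳ (assigned s) (↭-sym new↭old)) distinct
    u≢ : ∀ {y} → y ∈ ((v ∷ xs ++ ys) ++ vertices below) ++ assigned s → u ≢ y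
    u≢ y∈ refl = Distinct-++⇒∉ (u ∷ []) distinct' (here refl) y∈
    low-kept : ∀ {y} → y ∈ ((v ∷ xs ++ ys) ++ vertices below) ++ assigned s → low s' y ≡ low s y
    low-kept y∈ = update-≢ (low s) l' (u≢ y∈)
    low'≤low : ∀ y → low s' y ≤∞ low s y
    low'≤low y with u ≟ y
    ... | yes refl = min∞-≤ˡ (low s u) (low s v)
    ... | no _ = ≤∞-refl
    new⇒old : ∀ {y} → y ∈ vertices segs' → y ∈ vertices segs
    new⇒old = ∈-resp-↭ new↭old
    old⇒new : ∀ {y} → y ∈ vertices segs → y ∈ vertices segs'
    old⇒new = ∈-resp-↭ (↭-sym new↭old)
    merged : SegmentInvariant (pre s) (low s') (traversed s) u (v ∷ xs ++ ys) below
    merged = merged-segment (proj₁ invs) (proj₁ (proj₂ invs)) v-finished low≢pre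
      (v→z ◅◅ reach-owner u ys below (proj₂ invs) path-below z∈below)
      (arc⇒Reach e refl tip≡) (update-≡ (low s) u l') (λ y∈ → low-kept (∈-++⁺ˡ (∈-++⁺ˡ y∈)))
    I' : Invariant s' segs'
    I' = record
      { current≡top = refl
      ; F≡members = cong (v ∷_) (trans F≡members (sym (++-assoc xs ys (members below))))
      ; treePath = treePath-members below path-below
      ; phase-invariant = subst (λ p → PhaseInvariant (pre s) (low s') (traversed s) p segs') (sym explore≡)
          (merged , segments-transport below (λ _ → refl)
                      (λ y∈ → low-kept (∈-++⁺ˡ (∈-++⁺ʳ (v ∷ xs ++ ys) y∈))) (λ _ t → t) (proj₂ (proj₂ invs)))
      ; vertices-visited = λ y∈ → vertices-visited (new⇒old y∈)
      ; assigned-visited = assigned-visited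
      ; pre≤counter = λ y∈ → pre≤counter (new⇒old y∈)
      ; traversed⇒tip-visited = traversed⇒tip-visited
      ; traversed⇒tail-visited = traversed⇒tail-visited
      ; visited⇒located = λ y visited≡ → map₁ old⇒new (visited⇒located y visited≡)
      ; assigned-low∞ = λ y∈ → trans (low-kept (∈-++⁺ʳ ((v ∷ xs ++ ys) ++ vertices below) y∈)) (assigned-low∞ y∈)
      ; traversed-low≤pre = λ e y∈ t∈ tail≡ tip≡ traversed≡ →
          ≤∞-trans (low'≤low _) (traversed-low≤pre e (new⇒old y∈) (new⇒old t∈) tail≡ tip≡ traversed≡)
      ; distinct = distinct'
      ; outputs-components = outputs-components
      }
    gain : potential s' segs' ≡ suc (potential s segs)
    gain rewrite ↭-length new↭old =
      +-suc-inside (trueCount (traversed s)) (length (vertices segs)) (3 * length (assigned s)) (length (F s)) (poppingFlag (phase s))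
      where
      +-suc-inside : ∀ t b d f p → t + b + d + suc f + p ≡ suc (t + b + d + f + p)
      +-suc-inside = solve-∀

  potential≡ : ∀ s segs {A Fs p} → assigned s ≡ A → F s ≡ Fs → poppingFlag (phase s) ≡ p →
               potential s segs ≡ trueCount (traversed s) + length (vertices segs) + 3 * length A + length Fs + p
  potential≡ s segs refl refl refl = refl

  popping-halts-below : ∀ {pre low traversed v below x} → PoppingInvariant pre low v [] below →
                        SegmentsInvariant pre low traversed below → x ∈ members below → ¬ (low v ≤∞ low x)
  popping-halts-below {pre} {v = v} {below} pinv invs x∈ v≤x =
    let l , low≡ , l<pre = member-low<pre below invs x∈ in
    <⇒≱ (<-trans l<pre (PoppingInvariant.below<root pinv (members⊆vertices below x∈)))
        (subst₂ _≤∞_ (PoppingInvariant.low-root pinv) low≡ v≤x)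

  pop-↭ : ∀ v x xs below A → vertices ((v , xs) ∷ below) ++ x ∷ A ↭ vertices ((v , x ∷ xs) ∷ below) ++ A
  pop-↭ v x xs below A = prep v (shift x (xs ++ vertices below) A)

  pop-progress : ∀ s v S x F' → phase s ≡ popping v S → F s ≡ x ∷ F' → low s v ≤∞ low s x →
    Progress s (record s { F = F' ; phase = popping v (x ∷ S) ; low = update (low s) x ∞ })
  pop-progress s v S x F' popping≡ F≡ v≤x I with popping-invariant I popping≡
  ... | [] , below , refl , pinv , invs , _ , _ =
    ⊥-elim (popping-halts-below pinv invs (subst (x ∈_) (trans (sym F≡) (Invariant.F≡members I)) (here refl)) v≤x)
  ... | x₀ ∷ xs , below , refl , pinv , invs , S-mutual , component
    with ∷-injective (trans (sym F≡) (Invariant.F≡members I))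
  ... | refl , F'≡ = segs' , I' , ≤-reflexive (sym gain)
    where
    open Invariant I
    C = concat (outputs s)
    segs = (v , x ∷ xs) ∷ below
    segs' = (v , xs) ∷ below
    s' = record s { F = F' ; phase = popping v (x ∷ S) ; low = update (low s) x ∞ }
    assigned≡ : assigned s ≡ S ++ C
    assigned≡ = cong (λ p → popped p ++ C) popping≡
    new↭old : vertices segs' ++ assigned s' ↭ vertices segs ++ S ++ C
    new↭old = pop-↭ v x xs below (S ++ C)
    distinct-old : Distinct (vertices segs ++ S ++ C)
    distinct-old = subst (λ A → Distinct (vertices segs ++ A)) assigned≡ distinct
    distinct' : Distinct (vertices segs' ++ assigned s')
    distinct' = Distinct-resp-↭ (↭-sym new↭old) distinct-old
    x≢ : ∀ {y} → y ∈ vertices segs' → x ≢ y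
    x≢ y∈ refl = Distinct-++⇒∉ (vertices segs') distinct' y∈ (here refl)
    low-kept : ∀ {y} → y ∈ vertices segs' → low s' y ≡ low s y
    low-kept y∈ = update-≢ (low s) ∞ (x≢ y∈)
    new⇒old : ∀ {y} → y ∈ vertices segs' → y ∈ vertices segs
    new⇒old (here y≡v) = here y≡v
    new⇒old (there y∈) = there (there y∈)
    old-assigned : ∀ {y} → y ∈ S ++ C → y ∈ assigned s
    old-assigned y∈ = subst (_ ∈_) (sym assigned≡) y∈
    pinv' : PoppingInvariant (pre s) (low s') v xs below
    pinv' = record
      { low-root = trans (low-kept (here refl)) (PoppingInvariant.low-root pinv)
      ; low-member = λ y∈ → let l , low≡ , pre≤ = PoppingInvariant.low-member pinv (there y∈) in
          l , trans (low-kept (member∈ {v} {xs} {below} y∈)) low≡ , pre≤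
      ; member↔root = λ y∈ → PoppingInvariant.member↔root pinv (there y∈)
      ; below<root = PoppingInvariant.below<root pinv
      }
    S-mutual' : ∀ {y} → y ∈ x ∷ S → MutuallyReachable G v y
    S-mutual' (here refl) = let x→v , v→x = PoppingInvariant.member↔root pinv (here refl) in v→x , x→v
    S-mutual' (there y∈) = S-mutual y∈
    component' : ∀ w → MutuallyReachable G v w → w ≡ v ⊎ w ∈ xs ⊎ w ∈ x ∷ S
    component' w v↔w with component w v↔w
    ... | inj₁ w≡v = inj₁ w≡v
    ... | inj₂ (inj₁ (here w≡x)) = inj₂ (inj₂ (here w≡x))
    ... | inj₂ (inj₁ (there w∈xs)) = inj₂ (inj₁ w∈xs)
    ... | inj₂ (inj₂ w∈S) = inj₂ (inj₂ (there w∈S))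
    located : ∀ y → visited s y ≡ true → y ∈ vertices segs' ⊎ y ∈ assigned s'
    located y visited≡ with visited⇒located y visited≡
    ... | inj₂ y∈ = inj₂ (there (subst (y ∈_) assigned≡ y∈))
    ... | inj₁ (here y≡v) = inj₁ (here y≡v)
    ... | inj₁ (there (here y≡x)) = inj₂ (here y≡x)
    ... | inj₁ (there (there y∈)) = inj₁ (there y∈)
    I' : Invariant s' segs'
    I' = record
      { current≡top = current≡top
      ; F≡members = F'≡
      ; treePath = treePath-members below treePath
      ; phase-invariant = xs , below , refl , pinv' ,
          segments-transport below (λ _ → refl) (λ y∈ → low-kept (below∈ {v} {xs} y∈)) (λ _ t → t) invs ,
          S-mutual' , component'
      ; vertices-visited = λ y∈ → vertices-visited (new⇒old y∈)
      ; assigned-visited = λ { (here refl) → vertices-visited (there (here refl)) ; (there y∈) → assigned-visited (old-assigned y∈) }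
      ; pre≤counter = λ y∈ → pre≤counter (new⇒old y∈)
      ; traversed⇒tip-visited = traversed⇒tip-visited
      ; traversed⇒tail-visited = traversed⇒tail-visited
      ; visited⇒located = located
      ; assigned-low∞ = λ
          { (here refl) → update-≡ (low s) x ∞
          ; (there y∈) → trans (update-≢ (low s) {x} ∞ (λ { refl → Distinct-++⇒∉ (vertices segs) distinct-old (there (here refl)) y∈ }))
                               (assigned-low∞ (old-assigned y∈)) }
      ; traversed-low≤pre = λ e y∈ t∈ tail≡ tip≡ traversed≡ →
          subst (_≤∞ fin (pre s _)) (sym (low-kept y∈)) (traversed-low≤pre e (new⇒old y∈) (new⇒old t∈) tail≡ tip≡ traversed≡)
      ; distinct = distinct'
      ; outputs-components = outputs-components
      }
    gain : potential s' segs' ≡ suc (potential s segs)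
    gain = trans (shuffle (trueCount (traversed s)) (length (xs ++ vertices below)) (length (S ++ C)) (length F'))
                 (cong suc (sym (potential≡ s segs assigned≡ F≡ (cong poppingFlag popping≡))))
      where
      shuffle : ∀ t b a f → t + suc b + 3 * suc a + f + 1 ≡ suc (t + suc (suc b) + 3 * a + suc f + 1)
      shuffle = solve-∀

  popped-component : ∀ {v S} → (∀ {x} → x ∈ S → MutuallyReachable G v x) →
    (∀ w → MutuallyReachable G v w → w ≡ v ⊎ w ∈ [] ⊎ w ∈ S) → IsComponent (v ∷ S)
  popped-component {v} {S} S-mutual component = record
    { nonempty = v , here refl
    ; connected = λ u∈ w∈ → to-v u∈ ◅◅ from-v w∈
    ; closed = λ u∈ u→w w→u → back (component _ (from-v u∈ ◅◅ u→w , w→u ◅◅ to-v u∈))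
    }
    where
    to-v : ∀ {u} → u ∈ v ∷ S → Reach G u v
    to-v (here refl) = here
    to-v (there u∈) = proj₂ (S-mutual u∈)
    from-v : ∀ {u} → u ∈ v ∷ S → Reach G v u
    from-v (here refl) = here
    from-v (there u∈) = proj₁ (S-mutual u∈)
    back : ∀ {w} → w ≡ v ⊎ w ∈ [] ⊎ w ∈ S → w ∈ v ∷ S
    back (inj₁ w≡v) = here w≡v
    back (inj₂ (inj₂ w∈S)) = there w∈S

  output-progress : ∀ s v S below → phase s ≡ popping v S → Invariant s ((v , []) ∷ below) →
    PoppingInvariant (pre s) (low s) v [] below → SegmentsInvariant (pre s) (low s) (traversed s) below →
    (∀ {x} → x ∈ S → MutuallyReachable G v x) → (∀ w → MutuallyReachable G v w → w ≡ v ⊎ w ∈ [] ⊎ w ∈ S) →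
    (c : Maybe V) → c ≡ top below → (low' : V → ℕ∞) → (∀ y → low' y ≡ update (low s) v ∞ y) →
    Improves s ((v , []) ∷ below)
      (record s { phase = explore ; outputs = (v ∷ S) ∷ outputs s ; low = low' ; current = c })
  output-progress s v S below popping≡ I pinv invs S-mutual component c c≡top low' low'≡ =
    below , I' , ≤-reflexive (sym gain)
    where
    open Invariant I
    C = concat (outputs s)
    s' = record s { phase = explore ; outputs = (v ∷ S) ∷ outputs s ; low = low' ; current = c }
    assigned≡ : assigned s ≡ S ++ C
    assigned≡ = cong (λ p → popped p ++ C) popping≡
    distinct-old : Distinct (v ∷ vertices below ++ S ++ C)
    distinct-old = subst (λ A → Distinct (vertices ((v , []) ∷ below) ++ A)) assigned≡ distinct
    v↭ : vertices below ++ v ∷ S ++ C ↭ v ∷ vertices below ++ S ++ C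
    v↭ = shift v (vertices below) (S ++ C)
    low-kept : ∀ {y} → y ∈ vertices below → low' y ≡ low s y
    low-kept y∈ = trans (low'≡ _) (update-≢ (low s) {v} ∞ (λ { refl → Distinct-++⇒∉ (v ∷ []) distinct-old (here refl) (∈-++⁺ˡ y∈) }))
    old-assigned : ∀ {y} → y ∈ S ++ C → y ∈ assigned s
    old-assigned y∈ = subst (_ ∈_) (sym assigned≡) y∈
    located : ∀ y → visited s y ≡ true → y ∈ vertices below ⊎ y ∈ v ∷ S ++ C
    located y visited≡ with visited⇒located y visited≡
    ... | inj₁ (here y≡v) = inj₂ (here y≡v)
    ... | inj₁ (there y∈) = inj₁ y∈
    ... | inj₂ y∈ = inj₂ (there (subst (y ∈_) assigned≡ y∈))
    assigned-low∞' : ∀ {y} → y ∈ v ∷ S ++ C → low' y ≡ ∞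
    assigned-low∞' (here refl) = trans (low'≡ v) (update-≡ (low s) v ∞)
    assigned-low∞' {y} (there y∈) with v ≟ y | low'≡ y
    ... | yes refl | low'-y≡ = low'-y≡
    ... | no _ | low'-y≡ = trans low'-y≡ (assigned-low∞ (old-assigned y∈))
    I' : Invariant s' below
    I' = record
      { current≡top = c≡top
      ; F≡members = F≡members
      ; treePath = treePath-below below treePath
      ; phase-invariant = segments-transport below (λ _ → refl) low-kept (λ _ t → t) invs
      ; vertices-visited = λ y∈ → vertices-visited (there y∈)
      ; assigned-visited = λ { (here refl) → vertices-visited (here refl) ; (there y∈) → assigned-visited (old-assigned y∈) }
      ; pre≤counter = λ y∈ → pre≤counter (there y∈)
      ; traversed⇒tip-visited = traversed⇒tip-visited
      ; traversed⇒tail-visited = traversed⇒tail-visited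
      ; visited⇒located = located
      ; assigned-low∞ = assigned-low∞'
      ; traversed-low≤pre = λ e y∈ t∈ tail≡ tip≡ traversed≡ →
          subst (_≤∞ fin (pre s _)) (sym (low-kept y∈)) (traversed-low≤pre e (there y∈) (there t∈) tail≡ tip≡ traversed≡)
      ; distinct = Distinct-resp-↭ (↭-sym v↭) distinct-old
      ; outputs-components = λ { (here refl) → popped-component S-mutual component ; (there O∈) → outputs-components O∈ }
      }
    gain : potential s' below ≡ suc (potential s ((v , []) ∷ below))
    gain = trans (shuffle (trueCount (traversed s)) (length (vertices below)) (length (S ++ C)) (length (F s)))
                 (cong suc (sym (potential≡ s ((v , []) ∷ below) assigned≡ refl (cong poppingFlag popping≡))))
      where
      shuffle : ∀ t b a f → t + b + 3 * suc a + f + 0 ≡ suc (t + suc b + 3 * a + f + 1)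
      shuffle = solve-∀

  pop-done-progress : ∀ s v S → phase s ≡ popping v S → (∀ x F' → F s ≡ x ∷ F' → ¬ (low s v ≤∞ low s x)) →
    Progress s (leave v (record s { phase = explore ; outputs = (v ∷ S) ∷ outputs s ; low = update (low s) v ∞ }))
  pop-done-progress s v S popping≡ stop I with popping-invariant I popping≡
  ... | x ∷ xs , below , refl , pinv , _ , _ , _ =
    ⊥-elim (stop x (xs ++ members below) (Invariant.F≡members I) v≤x)
    where
    v≤x : low s v ≤∞ low s x
    v≤x = let l , low≡ , pre≤ = PoppingInvariant.low-member pinv (here refl) in
      subst₂ _≤∞_ (sym (PoppingInvariant.low-root pinv)) (sym low≡) pre≤
  ... | [] , [] , refl , pinv , invs , S-mutual , component =
    subst (Improves s ((v , []) ∷ [])) (sym (leave-root s₁ v (Invariant.treePath I)))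
      (output-progress s v S [] popping≡ I pinv invs S-mutual component nothing refl _ (λ _ → refl))
    where s₁ = record s { phase = explore ; outputs = (v ∷ S) ∷ outputs s ; low = update (low s) v ∞ }
  ... | [] , (u , ys) ∷ below , refl , pinv , invs , S-mutual , component with Invariant.treePath I
  ... | (e , in≡ , refl , _) , _ =
    subst (Improves s ((v , []) ∷ (u , ys) ∷ below)) (sym (leave-child s₁ v e in≡))
      (output-progress s v S ((u , ys) ∷ below) popping≡ I pinv invs S-mutual component (just u) refl _ unchanged)
    where
    s₁ = record s { phase = explore ; outputs = (v ∷ S) ∷ outputs s ; low = update (low s) v ∞ }
    -- v.low is already ∞ when the parent takes the minimum with it.
    unchanged : ∀ y → update (low s₁) u (min∞ (low s₁ u) (low s₁ v)) y ≡ low s₁ y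
    unchanged y = trans (cong (λ l → update (low s₁) u l y)
                              (trans (cong (min∞ (low s₁ u)) (update-≡ (low s) v ∞)) (min∞-identityʳ (low s₁ u))))
                        (update-self (low s₁) u y)

  step-progress : ∀ {s s'} → Step G s s' → Progress s s'
  step-progress (start s v explore≡ idle unvisited) = start-progress s v explore≡ idle unvisited
  step-progress (advance-visited s v a explore≡ current≡ tail≡ untraversed visited≡) =
    advance-visited-progress s v a explore≡ current≡ tail≡ untraversed visited≡
  step-progress (advance-tree s v a explore≡ current≡ tail≡ untraversed unvisited) =
    advance-tree-progress s v a explore≡ current≡ tail≡ untraversed unvisited
  step-progress (postvisit-push s v explore≡ current≡ finished low≢pre) =
    postvisit-push-progress s v explore≡ current≡ finished low≢pre
  step-progress (postvisit-root s v explore≡ current≡ finished low≡pre) =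
    postvisit-root-progress s v explore≡ current≡ finished low≡pre
  step-progress (pop s v S x F' popping≡ F≡ v≤x) = pop-progress s v S x F' popping≡ F≡ v≤x
  step-progress (pop-done s v S popping≡ stop) = pop-done-progress s v S popping≡ stop

  steps-progress : ∀ {k s s' segs} → Steps G k s s' → Invariant s segs →
                   ∃[ segs' ] (Invariant s' segs' × k + potential s segs ≤ potential s' segs')
  steps-progress done I = _ , I , ≤-refl
  steps-progress {suc k} {s} {segs = segs} (first ▸ run) I =
    let segs₁ , I₁ , gain₁ = step-progress first I
        segs' , I' , gain = steps-progress run I₁
    in segs' , I' , ≤-trans (≤-reflexive (sym (+-suc k (potential s segs)))) (≤-trans (+-monoʳ-≤ k gain₁) gain)

  step-vertex : ∀ {s s'} → Step G s s' → V
  step-vertex (start _ v _ _ _) = v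
  step-vertex (advance-visited _ v _ _ _ _ _ _) = v
  step-vertex (advance-tree _ v _ _ _ _ _ _) = v
  step-vertex (postvisit-push _ v _ _ _ _) = v
  step-vertex (postvisit-root _ v _ _ _ _) = v
  step-vertex (pop _ v _ _ _ _ _ _) = v
  step-vertex (pop-done _ v _ _ _) = v

  correct : ∀ k (s : State G) → Steps G k (initial G) s → Terminal G s → IsSCCPartition G (outputs s)
  correct k s run terminal = let _ , I , _ = steps-progress run initial-invariant in terminal⇒partition I terminal

  steps≤ : ∀ k (s : State G) → Steps G k (initial G) s → k ≤ m G + 5 * n G + 1
  steps≤ k s run = let _ , I , gain = steps-progress run initial-invariant in
    ≤-trans (m≤m+n k _) (≤-trans gain (potential≤ I))

linear-time : (d : ℕ) → ∃[ c ] ((G : Digraph) → n G ≤ d * m G → ∀ k (s : State G) → Steps G k (initial G) s → k ≤ c * m G)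
linear-time d = 2 + 5 * d , bound
  where
  bound : (G : Digraph) → n G ≤ d * m G → ∀ k (s : State G) → Steps G k (initial G) s → k ≤ (2 + 5 * d) * m G
  bound G n≤dm zero s run = z≤n
  bound G n≤dm (suc k) s run@(first ▸ _) = begin
    suc k                          ≤⟨ steps≤ (suc k) s run ⟩
    m G + 5 * n G + 1              ≤⟨ +-mono-≤ (+-monoʳ-≤ (m G) (*-monoʳ-≤ 5 n≤dm)) 1≤m ⟩
    m G + 5 * (d * m G) + m G      ≡⟨ collect (m G) d ⟩
    (2 + 5 * d) * m G              ∎
    where
    open ≤-Reasoning
    open AlgorithmT G
    1≤m : 1 ≤ m G
    1≤m with m G | ≤-trans (s≤s z≤n) (≤-trans (toℕ<n (step-vertex first)) n≤dm)
    ... | zero | 1≤d*0 = subst (1 ≤_) (*-zeroʳ d) 1≤d*0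
    ... | suc _ | _ = s≤s z≤n
    collect : ∀ m d → m + 5 * (d * m) + m ≡ (2 + 5 * d) * m
    collect = solve-∀

theorem2 : ((G : Digraph) → ∀ k (s : State G) → Steps G k (initial G) s → Terminal G s → IsSCCPartition G (outputs s))
    × ((d : ℕ) → ∃[ c ] ((G : Digraph) → n G ≤ d * m G → ∀ k (s : State G) → Steps G k (initial G) s → k ≤ c * m G))
theorem2 = AlgorithmT.correct , linear-time
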